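{- Let $X=\{x_1,\dots,x_M\}$ be a finite alphabet, $p,n\ge 0$ integers and $\lambda\vdash n$. Then $$s^{(p)}_\lambda(X)=\sum_{T\in SBT^{(p)}(\lambda)}\widetilde F_{comp(T)}(X).$$
   Context: Semistandard $(p)$-tableaux: a pair $T=(T^-,T^+)$ with $T^-$ a single row of $p$ boxes and $T^+$ a Young diagram of shape $\lambda$, filled with integers of $[M]$, non-decreasing along rows and strictly increasing down columns; $SSBT^{(p)}(\lambda)$ is the set of these, and $s^{(p)}_\lambda(X)=\sum_{T\in SSBT^{(p)}(\lambda)}\prod_{b\in T^+}x_{\text{entry}(b)}$ (entries of $T^-$ do not contribute). A standard $(p)$-tableau is such a pair whose boxes are filled with the integers of $[n+p]$, each used exactly once, increasing along rows and down columns; $SBT^{(p)}(\lambda)$ denotes their set. Weak compositions: a weak composition of $n$ is a tuple of non-negative integers summing to $n$, written $\alpha=(0^{j_1},s_1,0^{j_2},s_2,\dots,0^{j_k},s_k,0^{j_{k+1}})$ with $j_i\ge0$, $s_i>0$, $\sum s_i=n$ ($0^{j}$ means $j$ consecutive zeros). Put $a_r=j_1+s_1+\cdots+j_r+s_r$ for $r=1,\dots,k$, $D(\alpha)=\{a_1,\dots,a_k\}$ and $N=a_k+j_{k+1}$ (if $k=0$, $N=j_1$). Call a position $t\in[N]$ a zero position if it lies in one of the blocks $0^{j_r}$, i.e. $a_{r-1}<t\le a_{r-1}+j_r$ for some $r$ (with $a_0=0$, $a_{k+1}$ irrelevant, and the last block being $a_k<t\le N$). The weak composition fundamental quasisymmetric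 function is $$\widetilde F_\alpha(X)=\sum_{\substack{1\le i_1\le i_2\le\cdots\le i_N\le M\\ t\in D(\alpha),\ t<N\ \Rightarrow\ i_t<i_{t+1}}}\ \prod_{t\in[N]\text{ not a zero position}}x_{i_t}.$$ For $T\in SBT^{(p)}(\lambda)$, $comp(T)$ is the weak composition of $n$ obtained by reading the labels $k=1,2,\dots,n+p$ in increasing order: each label lying in $T^-$ contributes a part $0$, and the labels lying in $T^+$ are grouped into maximal runs of consecutive labels $k,k+1,\dots,k+s-1$ all in $T^+$ such that for no two consecutive labels $h,h+1$ of the run does $h$ lie in a strictly higher row than $h+1$; each such run contributes a part $s$, in the order in which they are read. (E.g. $T^-$ with entries $2,3,4$ and $T^+$ with rows $1\,5 / 6\,7 / 8$ gives $comp(T)=(1,0,0,0,1,2,1)$.) -}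

module Defs where

open import Level using (Level)
open import Data.Bool using (Bool; true; false; _∧_; not; if_then_else_)
open import Data.Nat using (ℕ; zero; suc; _+_; _≥_; _>_)
import Data.Nat
open import Data.Nat.ListAction using (sum)
open import Data.Bool.ListAction using (all; any)
open import Data.Fin using (Fin)
import Data.Fin as Fin
open import Data.List using (List; []; _∷_; [_]; map; concatMap; foldr; filterᵇ; concat; _++_; length; zip; allFin; cartesianProduct; replicate)
open import Data.List.Relation.Unary.All using (All)
open import Data.List.Relation.Unary.Linked using (Linked)
open import Data.Product using (_×_; _,_; proj₁; proj₂)
open import Relation.Nullary.Decidable using (⌊_⌋)
open import Algebra.Bundles using (CommutativeSemiring)

IsPartition : List ℕ → Set
IsPartition λs = Linked _≥_ λs × All (_> 0) λs

allLists : ∀ {a} {A : Set a} → List A → ℕ → List (List A)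
allLists xs zero    = [] ∷ []
allLists xs (suc k) = concatMap (λ x → map (x ∷_) (allLists xs k)) xs

-- all fillings of a Young diagram (given by its row lengths) with entries
-- from xs; a filling is the list of its rows (top row first)
allFillings : ∀ {a} {A : Set a} → List A → List ℕ → List (List (List A))
allFillings xs []       = [] ∷ []
allFillings xs (r ∷ rs) =
  concatMap (λ row → map (row ∷_) (allFillings xs rs)) (allLists xs r)

module _ {K : ℕ} where

  weakRow : List (Fin K) → Bool
  weakRow (a ∷ b ∷ r) = ⌊ a Fin.≤? b ⌋ ∧ weakRow (b ∷ r)
  weakRow _           = true

  strictRow : List (Fin K) → Bool
  strictRow (a ∷ b ∷ r) = ⌊ a Fin.<? b ⌋ ∧ strictRow (b ∷ r)
  strictRow _           = true

  -- columns strictly increasing downwards: compare each row with the next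
  -- (zip truncates to the shorter, i.e. lower, row)
  strictCols : List (List (Fin K)) → Bool
  strictCols (r₁ ∷ r₂ ∷ rs) =
    all (λ ab → ⌊ proj₁ ab Fin.<? proj₂ ab ⌋) (zip r₁ r₂) ∧ strictCols (r₂ ∷ rs)
  strictCols _ = true

  distinct : List (Fin K) → Bool
  distinct []      = true
  distinct (a ∷ r) = not (any (λ b → ⌊ a Fin.≟ b ⌋) r) ∧ distinct r

-- (p)-tableaux.  A pair T = (T⁻ , T⁺): T⁻ a single row (list of length p),
-- T⁺ a list of rows of shape λ.

BiTableau : ℕ → Set
BiTableau K = List (Fin K) × List (List (Fin K))

-- SSBT^(p)(λ) with entries in [M] (entry i ∈ [M] represented by Fin M)
SSBT : (M p : ℕ) → List ℕ → List (BiTableau M)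
SSBT M p λs =
  filterᵇ (λ T → weakRow (proj₁ T) ∧ all weakRow (proj₂ T) ∧ strictCols (proj₂ T))
          (cartesianProduct (allLists (allFin M) p) (allFillings (allFin M) λs))

-- SBT^(p)(λ): labels [n+p] (label k represented by Fin (n+p), in order),
-- each used exactly once, strictly increasing along rows and down columns.
SBT : (p : ℕ) → (λs : List ℕ) → List (BiTableau (sum λs + p))
SBT p λs =
  filterᵇ (λ T → strictRow (proj₁ T) ∧ all strictRow (proj₂ T) ∧ strictCols (proj₂ T)
                 ∧ distinct (proj₁ T ++ concat (proj₂ T)))
          (cartesianProduct (allLists (allFin K) p) (allFillings (allFin K) λs))
  where K = sum λs + p

-- where a label sits: in T⁻, or in row r (0 = top row) of T⁺
data Loc : Set where
  minus : Loc
  plus  : ℕ → Loc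

module _ {K : ℕ} where

  _∈ᵇ_ : Fin K → List (Fin K) → Bool
  k ∈ᵇ r = any (λ b → ⌊ k Fin.≟ b ⌋) r

  rowIndex : ℕ → List (List (Fin K)) → Fin K → Loc
  rowIndex i []       k = minus   -- unreachable for standard tableaux
  rowIndex i (r ∷ rs) k = if k ∈ᵇ r then plus i else rowIndex (suc i) rs k

  locate : BiTableau K → Fin K → Loc
  locate (Tm , Tp) k = if k ∈ᵇ Tm then minus else rowIndex 0 Tp k

mutual
  compLocs : List Loc → List ℕ
  compLocs []            = []
  compLocs (minus  ∷ ls) = 0 ∷ compLocs ls
  compLocs (plus r ∷ ls) = runLocs 1 r ls

  -- an open run of length s whose last label lies in row r
  runLocs : ℕ → ℕ → List Loc → List ℕ
  runLocs s r []             = s ∷ []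
  runLocs s r (minus   ∷ ls) = s ∷ 0 ∷ compLocs ls
  runLocs s r (plus r' ∷ ls) =
    -- break iff label h lies in a strictly higher row than h+1, i.e. r < r'
    if ⌊ r Data.Nat.<? r' ⌋ then s ∷ runLocs 1 r' ls else runLocs (suc s) r' ls

comp : ∀ {K} → BiTableau K → List ℕ
comp {K} T = compLocs (map (locate T) (allFin K))

module _ {c ℓ} (R : CommutativeSemiring c ℓ) where
  open CommutativeSemiring R using (Carrier; 0#; 1#) renaming (_+_ to _⊕_; _*_ to _⊗_)

  Σ[_]_ : ∀ {a} {A : Set a} → List A → (A → Carrier) → Carrier
  Σ[ xs ] f = foldr (λ x acc → f x ⊕ acc) 0# xs

  Π[_]_ : ∀ {a} {A : Set a} → List A → (A → Carrier) → Carrier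
  Π[ xs ] f = foldr (λ x acc → f x ⊗ acc) 1# xs

  schurP : (M p : ℕ) → List ℕ → (Fin M → Carrier) → Carrier
  schurP M p λs x = Σ[ SSBT M p λs ] (λ T → Π[ concat (proj₂ T) ] x)

  -- kinds of positions 1..N of a weak composition α:
  -- a zero part gives a zero position; a part s > 0 gives s positions,
  -- the last of which is the element a_r of D(α)
  data PosKind : Set where
    zpos inner dpos : PosKind

  kinds : List ℕ → List PosKind
  kinds []          = []
  kinds (zero  ∷ α) = zpos ∷ kinds α
  kinds (suc s ∷ α) = replicate s inner ++ dpos ∷ kinds α

  okSeq : ∀ {M} → List PosKind → List (Fin M) → Bool
  okSeq (dpos ∷ ks) (i ∷ j ∷ is) = ⌊ i Fin.<? j ⌋ ∧ okSeq ks (j ∷ is)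
  okSeq (_    ∷ ks) (i ∷ j ∷ is) = ⌊ i Fin.≤? j ⌋ ∧ okSeq ks (j ∷ is)
  okSeq _ _ = true

  weight : ∀ {M} → (Fin M → Carrier) → List PosKind → List (Fin M) → Carrier
  weight x (zpos ∷ ks) (i ∷ is) = weight x ks is
  weight x (_    ∷ ks) (i ∷ is) = x i ⊗ weight x ks is
  weight x _ _ = 1#

  Ftilde : (M : ℕ) → List ℕ → (Fin M → Carrier) → Carrier
  Ftilde M α x =
    Σ[ filterᵇ (okSeq (kinds α)) (allLists (allFin M) (length (kinds α))) ]
      (weight x (kinds α))

-- Standardization is a weight-preserving bijection between the semistandard (p)-tableaux S and
-- the pairs (T , s) of a standard (p)-tableau T and a weakly increasing sequence s that increases
-- strictly at every descent of comp(T). The boxes of S are numbered in increasing order of their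
-- entries, ties broken by reading T⁻ first and then the rows of T⁺ from the bottom up, each from
-- left to right; s lists the entries of S in increasing order. Conversely T is filled by writing
-- s_t into the box labelled t. A descent of comp(T) is a label t in T⁺ such that t + 1 lies in T⁻
-- or in a strictly lower row, so along equal values of s the labels only climb through T⁺: this
-- makes the filling semistandard and its standardization T again. The boxes of T⁻ are the zero
-- positions of comp(T), so the weights agree, and summing over T gives the sum of the F̃_{comp(T)}.

module Submission where

open import Algebra.Bundles using (CommutativeMonoid; CommutativeSemiring)
open import Data.Bool using (true; false; T; not; if_then_else_)
import Data.Bool as Bool
open import Data.Bool.ListAction using (any)
open import Data.Bool.Properties using (T-∧)
open import Data.Empty using (⊥; ⊥-elim)
open import Data.Fin using (Fin; toℕ)
import Data.Fin as Fin
import Data.Fin.Properties as Finₚ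
open import Data.Fin.Properties using (toℕ-injective; toℕ<n; toℕ-fromℕ<)
open import Data.List
  using (List; []; _∷_; [_]; map; concat; concatMap; foldr; filterᵇ; _++_; length; upTo; applyUpTo; zip; replicate;
         tabulate; cartesianProductWith; cartesianProduct; allFin)
open import Data.List.Properties
  using (∷-injective; zipWith-zeroʳ; length-zipWith; concatMap-cong; length-tabulate; length-upTo; length-map; upTo-∷ʳ;
         length-++; foldr-map; map-++; map-∘; map-id; map-cong; map-cong-local; map-injective; concat-map; concatMap-++;
         concatMap-map)
open import Data.List.Membership.Propositional using (_∈_; _∉_; find; lose)
open import Data.List.Membership.Propositional.Properties
  using (∈-∃++; ∈-map⁺; ∈-map⁻; ∈-upTo⁺; ∈-upTo⁻; ∈-++⁺ˡ; ∈-++⁺ʳ; ∈-++⁻; ∈-concat⁺′; ∈-concat⁻′; ∈-allFin;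
         ∈-cartesianProductWith⁺; ∈-cartesianProductWith⁻; ∈-cartesianProduct⁺; ∈-cartesianProduct⁻;
         ∈-filter⁺; ∈-filter⁻; ∈-concatMap⁺; ∈-concatMap⁻)
open import Data.List.Membership.Propositional.Properties.WithK using (unique∧set⇒bag)
open import Data.List.Relation.Binary.BagAndSetEquality using (∼bag⇒↭)
open import Data.List.Relation.Binary.Disjoint.Propositional using (Disjoint)
open import Data.List.Relation.Binary.Equality.Propositional using (≋⇒≡)
open import Data.List.Relation.Binary.Permutation.Propositional as ↭ using (_↭_; ↭-refl; ↭-trans; ↭-sym; prep; swap)
import Data.List.Relation.Binary.Permutation.Propositional.Properties as ↭ₚ
import Data.List.Relation.Binary.Permutation.Setoid.Properties as ↭ₛ
open import Data.List.Relation.Binary.Pointwise using ([]; _∷_) renaming (Pointwise to Pointwiseᴸ)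
open import Data.List.Relation.Unary.All as All using (All; []; _∷_)
import Data.List.Relation.Unary.All.Properties as Allₚ
open import Data.List.Relation.Unary.AllPairs as AllPairs using (AllPairs; []; _∷_)
import Data.List.Relation.Unary.AllPairs.Properties as AllPairsₚ
open import Data.List.Relation.Unary.Any using (here; there)
open import Data.List.Relation.Unary.Linked as Linked using (Linked; []; [-]; _∷_)
import Data.List.Relation.Unary.Linked.Properties as Linkedₚ
open import Data.List.Relation.Unary.Sorted.TotalOrder.Properties using (↗↭↗⇒≋)
open import Data.List.Relation.Unary.Unique.Propositional using (Unique)
import Data.List.Relation.Unary.Unique.Propositional.Properties as Unique
open import Data.Nat using (ℕ; zero; suc; _+_; _⊓_; _≤_; _<_; z≤n; s≤s; _≤?_; _<?_)
open import Data.Nat.ListAction using (sum)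
open import Data.Nat.Properties
  using (+-comm; +-identityʳ; +-suc; 1+n≰n; <-asym; <-cmp; <-irrefl; <-trans; <⇒≤; <⇒≱;
         m≢1+m+n; m≤n⇒m<n∨m≡n; m≤n⇒m≤1+n; m≤n⇒m⊓n≡m; m≥n⇒m⊓n≡n; n<1+n; n≮0; suc-injective; ≤-<-trans; ≤-antisym;
         ≤-pred; ≤-refl; ≤-reflexive; ≤-trans; ≮⇒≥; ⊓-zeroʳ; ⊓-idem)
open import Data.Product using (_×_; _,_; proj₁; proj₂; ∃; uncurry)
open import Data.Product.Relation.Binary.Lex.Strict using (×-Lex; ×-transitive; ×-compare)
open import Data.Product.Relation.Binary.Pointwise.NonDependent using (Pointwise; ≡×≡⇒≡)
open import Data.Sum using (_⊎_; inj₁; inj₂)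
open import Data.Unit using (⊤)
open import Function using (_∘_; id; mk⇔; Equivalence)
open import Level using (Level)
open import Relation.Binary using (Trichotomous; Tri; tri<; tri≈; tri>)
open import Relation.Binary.Consequences using (tri⇒dec<)
open import Relation.Binary.PropositionalEquality as ≡
  using (_≡_; _≢_; refl; sym; trans; cong; cong₂; subst; subst₂; module ≡-Reasoning)
open import Relation.Nullary using (¬_; Dec; yes; no; does)
open import Relation.Nullary.Decidable using (⌊_⌋; T?; toWitness; fromWitness)
open import Relation.Unary using (Pred; Decidable)

open import Defs

private variable
  a b : Level
  A B : Set a

infix 4 _[_]=_

data _[_]=_ {A : Set a} : List A → ℕ → A → Set a where
  here  : ∀ {x xs} → x ∷ xs [ 0 ]= x
  there : ∀ {x xs i y} → xs [ i ]= y → x ∷ xs [ suc i ]= y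

[]=-functional : ∀ {xs : List A} {i y z} → xs [ i ]= y → xs [ i ]= z → y ≡ z
[]=-functional here      here      = refl
[]=-functional (there p) (there q) = []=-functional p q

[]=⇒<length : ∀ {xs : List A} {i y} → xs [ i ]= y → i < length xs
[]=⇒<length here      = s≤s z≤n
[]=⇒<length (there p) = s≤s ([]=⇒<length p)

<length⇒[]= : ∀ (xs : List A) {i} → i < length xs → ∃ λ y → xs [ i ]= y
<length⇒[]= (x ∷ xs) {zero}  _       = x , here
<length⇒[]= (x ∷ xs) {suc i} (s≤s p) = let y , q = <length⇒[]= xs p in y , there q

[]=⇒∈ : ∀ {xs : List A} {i y} → xs [ i ]= y → y ∈ xs
[]=⇒∈ here      = here refl
[]=⇒∈ (there p) = there ([]=⇒∈ p)

∈⇒[]= : ∀ {xs : List A} {y} → y ∈ xs → ∃ λ i → xs [ i ]= y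
∈⇒[]= (here refl) = 0 , here
∈⇒[]= (there p)   = let i , q = ∈⇒[]= p in suc i , there q

map-[]=⁺ : ∀ (f : A → B) {xs i y} → xs [ i ]= y → map f xs [ i ]= f y
map-[]=⁺ f here      = here
map-[]=⁺ f (there p) = there (map-[]=⁺ f p)

map-[]=⁻ : ∀ (f : A → B) {xs i z} → map f xs [ i ]= z → ∃ λ y → xs [ i ]= y × z ≡ f y
map-[]=⁻ f {_ ∷ _} here      = _ , here , refl
map-[]=⁻ f {_ ∷ _} (there p) = let y , q , e = map-[]=⁻ f p in y , there q , e

zip-[]=⁺ : ∀ {xs : List A} {ys : List B} {i x y} → xs [ i ]= x → ys [ i ]= y → zip xs ys [ i ]= (x , y)
zip-[]=⁺ here      here      = here
zip-[]=⁺ (there p) (there q) = there (zip-[]=⁺ p q)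

zip-[]=⁻ : ∀ (xs : List A) (ys : List B) {i xy} → zip xs ys [ i ]= xy → xs [ i ]= proj₁ xy × ys [ i ]= proj₂ xy
zip-[]=⁻ (_ ∷ xs) (_ ∷ ys) here      = here , here
zip-[]=⁻ (_ ∷ xs) (_ ∷ ys) (there p) = let q , r = zip-[]=⁻ xs ys p in there q , there r

elemAt : List A → ℕ → List A
elemAt []       _       = []
elemAt (x ∷ xs) zero    = [ x ]
elemAt (x ∷ xs) (suc n) = elemAt xs n

elemAt-[]= : ∀ {xs : List A} {n y} → xs [ n ]= y → elemAt xs n ≡ [ y ]
elemAt-[]= here      = refl
elemAt-[]= (there p) = elemAt-[]= p

map-elemAt : ∀ (f : A → B) xs n → map f (elemAt xs n) ≡ elemAt (map f xs) n
map-elemAt f []       _       = refl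
map-elemAt f (x ∷ xs) zero    = refl
map-elemAt f (x ∷ xs) (suc n) = map-elemAt f xs n

concatMap-elemAt-upTo : ∀ (xs : List A) → concatMap (elemAt xs) (upTo (length xs)) ≡ xs
concatMap-elemAt-upTo []       = refl
concatMap-elemAt-upTo (x ∷ xs) = cong (x ∷_) (trans (drop-head (length xs) (λ i → i)) (concatMap-elemAt-upTo xs))
  where
    drop-head : ∀ n f → concatMap (elemAt (x ∷ xs)) (applyUpTo (suc ∘ f) n) ≡ concatMap (elemAt xs) (applyUpTo f n)
    drop-head zero    f = refl
    drop-head (suc n) f = cong (elemAt xs (f 0) ++_) (drop-head n (f ∘ suc))

elemAt-zip : ∀ (xs : List A) (ys : List B) n → elemAt (zip xs ys) n ≡ zip (elemAt xs n) (elemAt ys n)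
elemAt-zip []       ys       n       = refl
elemAt-zip (x ∷ xs) []       n       = sym (zipWith-zeroʳ _,_ (elemAt (x ∷ xs) n))
elemAt-zip (x ∷ xs) (y ∷ ys) zero    = refl
elemAt-zip (x ∷ xs) (y ∷ ys) (suc n) = elemAt-zip xs ys n

zip≡concatMap-elemAt : ∀ (xs : List A) (ys : List B) → length xs ≡ length ys →
  zip xs ys ≡ concatMap (λ n → zip (elemAt xs n) (elemAt ys n)) (upTo (length xs))
zip≡concatMap-elemAt xs ys |xs|≡|ys| = begin
  zip xs ys                                              ≡⟨ concatMap-elemAt-upTo (zip xs ys) ⟨
  concatMap (elemAt (zip xs ys)) (upTo (length (zip xs ys))) ≡⟨ cong (concatMap (elemAt (zip xs ys)) ∘ upTo) |zip| ⟩
  concatMap (elemAt (zip xs ys)) (upTo (length xs))      ≡⟨ concatMap-cong (elemAt-zip xs ys) (upTo (length xs)) ⟩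
  concatMap (λ n → zip (elemAt xs n) (elemAt ys n)) (upTo (length xs)) ∎
  where
    open ≡-Reasoning
    |zip| : length (zip xs ys) ≡ length xs
    |zip| = trans (length-zipWith _,_ xs ys) (trans (cong (length xs ⊓_) (sym |xs|≡|ys|)) (⊓-idem (length xs)))

elemAt-cases : ∀ (xs : List A) n → elemAt xs n ≡ [] ⊎ ∃ λ y → elemAt xs n ≡ [ y ]
elemAt-cases []       _       = inj₁ refl
elemAt-cases (x ∷ xs) zero    = inj₂ (x , refl)
elemAt-cases (x ∷ xs) (suc n) = elemAt-cases xs n

-- The junk value 0 past the end is never used.
nth : List ℕ → ℕ → ℕ
nth []       _       = 0
nth (x ∷ xs) zero    = x
nth (x ∷ xs) (suc n) = nth xs n

nth-[]= : ∀ xs {n} → n < length xs → xs [ n ]= nth xs n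
nth-[]= (x ∷ xs) {zero}  _       = here
nth-[]= (x ∷ xs) {suc n} (s≤s p) = there (nth-[]= xs p)

module _ {p} {P : Pred A p} (P? : Decidable P) where

  count : List A → ℕ
  count []       = 0
  count (x ∷ xs) = if does (P? x) then suc (count xs) else count xs

  count-≤length : ∀ xs → count xs ≤ length xs
  count-≤length []       = z≤n
  count-≤length (x ∷ xs) with P? x
  ... | yes _ = s≤s (count-≤length xs)
  ... | no  _ = m≤n⇒m≤1+n (count-≤length xs)

  count-<length : ∀ {xs y} → y ∈ xs → ¬ P y → count xs < length xs
  count-<length {x ∷ xs} (here refl) ¬Py with P? x
  ... | yes Py = ⊥-elim (¬Py Py)
  ... | no  _  = s≤s (count-≤length xs)
  count-<length {x ∷ xs} (there y∈) ¬Py with P? x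
  ... | yes _ = s≤s (count-<length y∈ ¬Py)
  ... | no  _ = m≤n⇒m≤1+n (count-<length y∈ ¬Py)

  count-↭ : ∀ {xs ys} → xs ↭ ys → count xs ≡ count ys
  count-↭ ↭.refl = refl
  count-↭ (prep x q) with P? x
  ... | yes _ = cong suc (count-↭ q)
  ... | no  _ = count-↭ q
  count-↭ (swap x y q) with P? x | P? y
  ... | yes _ | yes _ = cong (suc ∘ suc) (count-↭ q)
  ... | yes _ | no  _ = cong suc (count-↭ q)
  ... | no  _ | yes _ = cong suc (count-↭ q)
  ... | no  _ | no  _ = count-↭ q
  count-↭ (↭.trans q r) = trans (count-↭ q) (count-↭ r)

  count-++ : ∀ xs ys → count (xs ++ ys) ≡ count xs + count ys
  count-++ []       ys = refl
  count-++ (x ∷ xs) ys with P? x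
  ... | yes _ = cong suc (count-++ xs ys)
  ... | no  _ = count-++ xs ys

  count-none : ∀ xs → All (¬_ ∘ P) xs → count xs ≡ 0
  count-none []       []          = refl
  count-none (x ∷ xs) (¬Px ∷ ¬Ps) with P? x
  ... | yes Px = ⊥-elim (¬Px Px)
  ... | no  _  = count-none xs ¬Ps

module _ {p q} {P : Pred A p} {Q : Pred A q} (P? : Decidable P) (Q? : Decidable Q) where

  count-mono : ∀ xs → (∀ {x} → x ∈ xs → P x → Q x) → count P? xs ≤ count Q? xs
  count-mono []       _   = z≤n
  count-mono (x ∷ xs) P⇒Q with P? x | Q? x
  ... | yes _  | yes _  = s≤s (count-mono xs (P⇒Q ∘ there))
  ... | yes Px | no ¬Qx = ⊥-elim (¬Qx (P⇒Q (here refl) Px))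
  ... | no  _  | yes _  = m≤n⇒m≤1+n (count-mono xs (P⇒Q ∘ there))
  ... | no  _  | no  _  = count-mono xs (P⇒Q ∘ there)

  count-strict : ∀ xs → (∀ {x} → x ∈ xs → P x → Q x) → ∀ {y} → y ∈ xs → Q y → ¬ P y →
                 count P? xs < count Q? xs
  count-strict (x ∷ xs) P⇒Q (here refl) Qy ¬Py with P? x | Q? x
  ... | yes Py | _      = ⊥-elim (¬Py Py)
  ... | no  _  | yes _  = s≤s (count-mono xs (P⇒Q ∘ there))
  ... | no  _  | no ¬Qy = ⊥-elim (¬Qy Qy)
  count-strict (x ∷ xs) P⇒Q (there y∈) Qy ¬Py with P? x | Q? x
  ... | yes _  | yes _  = s≤s (count-strict xs (P⇒Q ∘ there) y∈ Qy ¬Py)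
  ... | yes Px | no ¬Qx = ⊥-elim (¬Qx (P⇒Q (here refl) Px))
  ... | no  _  | yes _  = m≤n⇒m≤1+n (count-strict xs (P⇒Q ∘ there) y∈ Qy ¬Py)
  ... | no  _  | no  _  = count-strict xs (P⇒Q ∘ there) y∈ Qy ¬Py

count-map : ∀ {p} {P : Pred B p} (P? : Decidable P) (f : A → B) xs → count P? (map f xs) ≡ count (P? ∘ f) xs
count-map P? f []       = refl
count-map P? f (x ∷ xs) with P? (f x)
... | yes _ = cong suc (count-map P? f xs)
... | no  _ = count-map P? f xs

count<-upTo : ∀ k n → count (_<? k) (upTo n) ≡ k ⊓ n
count<-upTo k zero    = sym (⊓-zeroʳ k)
count<-upTo k (suc n) = begin
  count (_<? k) (upTo (suc n))                 ≡⟨ cong (count (_<? k)) (sym (upTo-∷ʳ n)) ⟩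
  count (_<? k) (upTo n ++ [ n ])              ≡⟨ count-++ (_<? k) (upTo n) [ n ] ⟩
  count (_<? k) (upTo n) + count (_<? k) [ n ] ≡⟨ cong (_+ count (_<? k) [ n ]) (count<-upTo k n) ⟩
  k ⊓ n + count (_<? k) [ n ]                  ≡⟨ last-step (n <? k) ⟩
  k ⊓ suc n                                    ∎
  where
    open ≡-Reasoning
    last-step : (n<?k : Dec (n < k)) → k ⊓ n + (if does n<?k then 1 else 0) ≡ k ⊓ suc n
    last-step (yes n<k) = begin
      k ⊓ n + 1 ≡⟨ cong (_+ 1) (m≥n⇒m⊓n≡n (<⇒≤ n<k)) ⟩
      n + 1     ≡⟨ +-comm n 1 ⟩
      suc n     ≡⟨ sym (m≥n⇒m⊓n≡n n<k) ⟩
      k ⊓ suc n ∎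
    last-step (no n≮k) = begin
      k ⊓ n + 0 ≡⟨ +-identityʳ (k ⊓ n) ⟩
      k ⊓ n     ≡⟨ m≤n⇒m⊓n≡m (≮⇒≥ n≮k) ⟩
      k         ≡⟨ sym (m≤n⇒m⊓n≡m (m≤n⇒m≤1+n (≮⇒≥ n≮k))) ⟩
      k ⊓ suc n ∎

module _ {p} {P : Pred ℕ p} (P? : Decidable P) (P-down : ∀ {x y} → y ≤ x → P x → P y) where

  []=⇒<count : ∀ {s t w} → AllPairs _≤_ s → s [ t ]= w → P w → t < count P? s
  []=⇒<count {x ∷ s} (x≤s ∷ s↗) s[t] Pw with P? x | s[t]
  ... | yes _  | here      = s≤s z≤n
  ... | yes _  | there s[t]′ = s≤s ([]=⇒<count s↗ s[t]′ Pw)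
  ... | no ¬Px | here      = ⊥-elim (¬Px Pw)
  ... | no ¬Px | there s[t]′ = ⊥-elim (¬Px (P-down (All.lookup x≤s ([]=⇒∈ s[t]′)) Pw))

  <count⇒[]= : ∀ {s t w} → AllPairs _≤_ s → s [ t ]= w → t < count P? s → P w
  <count⇒[]= {x ∷ s} (x≤s ∷ s↗) s[t] t< with P? x | s[t] | t<
  ... | yes Px | here        | _       = Px
  ... | yes _  | there s[t]′ | s≤s t<′ = <count⇒[]= s↗ s[t]′ t<′
  ... | no ¬Px | _           | t<′     =
    ⊥-elim (n≮0 (subst (_ <_) (count-none P? s (All.map (λ x≤y Py → ¬Px (P-down x≤y Py)) x≤s)) t<′))

module _ {A : Set a} where

  Unique-++⇒∉ : ∀ {xs ys : List A} {z} → Unique (xs ++ ys) → z ∈ xs → z ∉ ys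
  Unique-++⇒∉ {_ ∷ xs} (z∉ ∷ _) (here refl) z∈ys = All.lookup z∉ (∈-++⁺ʳ xs z∈ys) refl
  Unique-++⇒∉ {_ ∷ _}  (_ ∷ u)  (there z∈)  z∈ys = Unique-++⇒∉ u z∈ z∈ys

  Unique-++⇒Uniqueʳ : ∀ {xs ys : List A} → Unique (xs ++ ys) → Unique ys
  Unique-++⇒Uniqueʳ {[]}     u       = u
  Unique-++⇒Uniqueʳ {_ ∷ xs} (_ ∷ u) = Unique-++⇒Uniqueʳ {xs = xs} u

  unique-⊆-↭ : ∀ {xs ys : List A} → Unique xs → Unique ys → (∀ {z} → z ∈ xs → z ∈ ys) →
               length ys ≤ length xs → xs ↭ ys
  unique-⊆-↭ {[]}     {[]}    _ _ _ _ = ↭-refl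
  unique-⊆-↭ {x ∷ xs} (x∉xs ∷ xs!) ys! xs⊆ys |ys|≤ with ∈-∃++ (xs⊆ys (here refl))
  ... | ys₁ , ys₂ , refl = ↭-trans (prep x (unique-⊆-↭ xs! ys₁₂! xs⊆ys₁₂ |ys₁₂|≤)) (↭-sym (↭ₚ.shift x ys₁ ys₂))
    where
      ys₁₂! : Unique (ys₁ ++ ys₂)
      ys₁₂! with _ ∷ u ← ↭ₛ.Unique-resp-↭ (≡.setoid A) (↭.↭⇒↭ₛ (↭ₚ.shift x ys₁ ys₂)) ys! = u
      xs⊆ys₁₂ : ∀ {z} → z ∈ xs → z ∈ ys₁ ++ ys₂
      xs⊆ys₁₂ z∈xs with ↭ₚ.Any-resp-↭ (↭ₚ.shift x ys₁ ys₂) (xs⊆ys (there z∈xs))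
      ... | here refl = ⊥-elim (All.lookup x∉xs z∈xs refl)
      ... | there z∈  = z∈
      |ys₁₂|≤ : length (ys₁ ++ ys₂) ≤ length xs
      |ys₁₂|≤ = ≤-pred (subst (_≤ suc (length xs)) (↭ₚ.↭-length (↭ₚ.shift x ys₁ ys₂)) |ys|≤)

  unique-set⇒↭ : ∀ {xs ys : List A} → Unique xs → Unique ys →
                 (∀ {z} → z ∈ xs → z ∈ ys) → (∀ {z} → z ∈ ys → z ∈ xs) → xs ↭ ys
  unique-set⇒↭ xs! ys! xs⊆ys ys⊆xs = ∼bag⇒↭ (unique∧set⇒bag xs! ys! (mk⇔ xs⊆ys ys⊆xs))

concatMap-↭ : ∀ (f : A → List B) {xs ys} → xs ↭ ys → concatMap f xs ↭ concatMap f ys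
concatMap-↭ f ↭.refl         = ↭-refl
concatMap-↭ f (prep x p)     = ↭ₚ.++⁺ˡ (f x) (concatMap-↭ f p)
concatMap-↭ f (swap x y p)   = ↭-trans (↭ₚ.shifts (f x) (f y)) (↭ₚ.++⁺ˡ (f y) (↭ₚ.++⁺ˡ (f x) (concatMap-↭ f p)))
concatMap-↭ f (↭.trans p q)  = ↭-trans (concatMap-↭ f p) (concatMap-↭ f q)

module _ {A : Set a} {B : Set b} (f : A → B) where

  map⁺-injectiveOn : ∀ {xs} → Unique xs → (∀ {x y} → x ∈ xs → y ∈ xs → f x ≡ f y → x ≡ y) → Unique (map f xs)
  map⁺-injectiveOn {[]}     []         _   = []
  map⁺-injectiveOn {x ∷ xs} (x∉ ∷ xs!) inj =
    Allₚ.map⁺ (All.tabulate (λ y∈ fx≡fy → All.lookup x∉ y∈ (inj (here refl) (there y∈) fx≡fy))) ∷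
    map⁺-injectiveOn xs! (λ x∈ y∈ → inj (there x∈) (there y∈))

  map⁻-injectiveOn : ∀ {xs} → Unique (map f xs) → ∀ {x y} → x ∈ xs → y ∈ xs → f x ≡ f y → x ≡ y
  map⁻-injectiveOn {_ ∷ _} _          (here refl) (here refl) _ = refl
  map⁻-injectiveOn {_ ∷ _} (fx∉ ∷ _)  (here refl) (there y∈)  e = ⊥-elim (All.lookup fx∉ (∈-map⁺ f y∈) e)
  map⁻-injectiveOn {_ ∷ _} (fy∉ ∷ _)  (there x∈)  (here refl) e = ⊥-elim (All.lookup fy∉ (∈-map⁺ f x∈) (sym e))
  map⁻-injectiveOn {_ ∷ _} (_ ∷ fxs!) (there x∈)  (there y∈)  e = map⁻-injectiveOn fxs! x∈ y∈ e

module BigOperator {c ℓ} (M : CommutativeMonoid c ℓ) where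
  open CommutativeMonoid M
    using (Carrier; _≈_; _∙_; ε; setoid; isCommutativeMonoid; isEquivalence; ∙-cong; ∙-congˡ; assoc; identityˡ)
    renaming (refl to ≈-refl; sym to ≈-sym; trans to ≈-trans)
  open import Relation.Binary.Reasoning.Setoid setoid

  ⨁ : List A → (A → Carrier) → Carrier
  ⨁ xs f = foldr (λ x acc → f x ∙ acc) ε xs

  ⨁-map : ∀ (g : A → B) xs (f : B → Carrier) → ⨁ (map g xs) f ≡ ⨁ xs (f ∘ g)
  ⨁-map g []       f = refl
  ⨁-map g (x ∷ xs) f = cong (f (g x) ∙_) (⨁-map g xs f)

  ⨁-↭ : ∀ (f : A → Carrier) {xs ys} → xs ↭ ys → ⨁ xs f ≈ ⨁ ys f
  ⨁-↭ f {xs} {ys} xs↭ys = begin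
    ⨁ xs f                  ≡⟨ foldr-map _∙_ f ε xs ⟨
    foldr _∙_ ε (map f xs)  ≈⟨ ↭ₛ.foldr-commMonoid setoid isCommutativeMonoid
                                 (↭.↭⇒↭ₛ′ isEquivalence (↭ₚ.map⁺ f xs↭ys)) ⟩
    foldr _∙_ ε (map f ys)  ≡⟨ foldr-map _∙_ f ε ys ⟩
    ⨁ ys f                  ∎

  ⨁-cong : ∀ xs {f g : A → Carrier} → (∀ {x} → x ∈ xs → f x ≈ g x) → ⨁ xs f ≈ ⨁ xs g
  ⨁-cong []       _   = ≈-refl
  ⨁-cong (x ∷ xs) f≈g = ∙-cong (f≈g (here refl)) (⨁-cong xs (f≈g ∘ there))

  ⨁-++ : ∀ xs ys (f : A → Carrier) → ⨁ (xs ++ ys) f ≈ ⨁ xs f ∙ ⨁ ys f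
  ⨁-++ []       ys f = ≈-sym (identityˡ _)
  ⨁-++ (x ∷ xs) ys f = ≈-trans (∙-congˡ (⨁-++ xs ys f)) (≈-sym (assoc _ _ _))

  ⨁-concatMap : ∀ (g : A → List B) xs (f : B → Carrier) → ⨁ (concatMap g xs) f ≈ ⨁ xs (λ x → ⨁ (g x) f)
  ⨁-concatMap g []       f = ≈-refl
  ⨁-concatMap g (x ∷ xs) f = ≈-trans (⨁-++ (g x) (concatMap g xs) f) (∙-congˡ (⨁-concatMap g xs f))

  ⨁-identity : ∀ xs (f : A → Carrier) → (∀ {x} → x ∈ xs → f x ≈ ε) → ⨁ xs f ≈ ε
  ⨁-identity []       f _     = ≈-refl
  ⨁-identity (x ∷ xs) f f≈ε = ≈-trans (∙-cong (f≈ε (here refl)) (⨁-identity xs f (f≈ε ∘ there))) (identityˡ ε)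

  ⨁-bijection : ∀ {xs : List A} {ys : List B} (f : A → Carrier) (g : B → Carrier) (φ : A → B) (ψ : B → A) →
    Unique xs → Unique ys → (∀ {x} → x ∈ xs → φ x ∈ ys) → (∀ {y} → y ∈ ys → ψ y ∈ xs) →
    (∀ {x} → x ∈ xs → ψ (φ x) ≡ x) → (∀ {y} → y ∈ ys → φ (ψ y) ≡ y) →
    (∀ {x} → x ∈ xs → f x ≈ g (φ x)) → ⨁ xs f ≈ ⨁ ys g
  ⨁-bijection {xs = xs} {ys} f g φ ψ xs! ys! φ∈ ψ∈ ψφ φψ f≈gφ = begin
    ⨁ xs f         ≈⟨ ⨁-cong xs f≈gφ ⟩
    ⨁ xs (g ∘ φ)   ≡⟨ ⨁-map φ xs g ⟨
    ⨁ (map φ xs) g ≈⟨ ⨁-↭ g (unique-set⇒↭ φxs! ys! φxs⊆ys ys⊆φxs) ⟩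
    ⨁ ys g         ∎
    where
      φxs! : Unique (map φ xs)
      φxs! = map⁺-injectiveOn φ xs! (λ x∈ y∈ e → trans (sym (ψφ x∈)) (trans (cong ψ e) (ψφ y∈)))
      φxs⊆ys : ∀ {y} → y ∈ map φ xs → y ∈ ys
      φxs⊆ys y∈ with x , x∈ , refl ← ∈-map⁻ φ y∈ = φ∈ x∈
      ys⊆φxs : ∀ {y} → y ∈ ys → y ∈ map φ xs
      ys⊆φxs y∈ = subst (_∈ map φ xs) (φψ y∈) (∈-map⁺ φ (ψ∈ y∈))

concatMap-map≡cartesianProductWith : ∀ {c} {C : Set c} (f : A → B → C) xs ys →
  concatMap (λ x → map (f x) ys) xs ≡ cartesianProductWith f xs ys
concatMap-map≡cartesianProductWith f []       ys = refl
concatMap-map≡cartesianProductWith f (x ∷ xs) ys = cong (map (f x) ys ++_) (concatMap-map≡cartesianProductWith f xs ys)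

module _ {A : Set a} (xs : List A) where

  allLists≡ : ∀ k → allLists xs (suc k) ≡ cartesianProductWith _∷_ xs (allLists xs k)
  allLists≡ k = concatMap-map≡cartesianProductWith _∷_ xs (allLists xs k)

  allFillings≡ : ∀ r rs → allFillings xs (r ∷ rs) ≡ cartesianProductWith _∷_ (allLists xs r) (allFillings xs rs)
  allFillings≡ r rs = concatMap-map≡cartesianProductWith _∷_ (allLists xs r) (allFillings xs rs)

  ∈-allLists⁻ : ∀ k {ys} → ys ∈ allLists xs k → length ys ≡ k × All (_∈ xs) ys
  ∈-allLists⁻ zero    (here refl) = refl , []
  ∈-allLists⁻ (suc k) ys∈ with ∈-cartesianProductWith⁻ _∷_ xs (allLists xs k) (subst (_ ∈_) (allLists≡ k) ys∈)
  ... | y , zs , y∈ , zs∈ , refl = let |zs| , zs⊆ = ∈-allLists⁻ k zs∈ in cong suc |zs| , y∈ ∷ zs⊆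

  ∈-allLists⁺ : ∀ {ys} → All (_∈ xs) ys → ys ∈ allLists xs (length ys)
  ∈-allLists⁺ {[]} []             = here refl
  ∈-allLists⁺ {y ∷ ys} (y∈ ∷ ys⊆) =
    subst (y ∷ ys ∈_) (sym (allLists≡ (length ys))) (∈-cartesianProductWith⁺ _∷_ y∈ (∈-allLists⁺ ys⊆))

  allLists⁺ : Unique xs → ∀ k → Unique (allLists xs k)
  allLists⁺ xs! zero    = [] ∷ []
  allLists⁺ xs! (suc k) = subst Unique (sym (allLists≡ k))
    (Unique.cartesianProductWith⁺ _∷_ ∷-injective xs! (allLists⁺ xs! k))

  FillingOf : List (List A) → List ℕ → Set a
  FillingOf = Pointwiseᴸ (λ row r → length row ≡ r × All (_∈ xs) row)

  ∈-allFillings⁻ : ∀ rs {F} → F ∈ allFillings xs rs → FillingOf F rs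
  ∈-allFillings⁻ []       (here refl) = []
  ∈-allFillings⁻ (r ∷ rs) F∈
    with ∈-cartesianProductWith⁻ _∷_ (allLists xs r) (allFillings xs rs) (subst (_ ∈_) (allFillings≡ r rs) F∈)
  ... | row , G , row∈ , G∈ , refl = ∈-allLists⁻ r row∈ ∷ ∈-allFillings⁻ rs G∈

  ∈-allFillings⁺ : ∀ {rs F} → FillingOf F rs → F ∈ allFillings xs rs
  ∈-allFillings⁺ []                       = here refl
  ∈-allFillings⁺ {r ∷ rs} {row ∷ F} ((refl , row⊆) ∷ F∼rs) = subst (row ∷ F ∈_) (sym (allFillings≡ r rs))
    (∈-cartesianProductWith⁺ _∷_ (∈-allLists⁺ row⊆) (∈-allFillings⁺ F∼rs))

  allFillings⁺ : Unique xs → ∀ rs → Unique (allFillings xs rs)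
  allFillings⁺ xs! []       = [] ∷ []
  allFillings⁺ xs! (r ∷ rs) = subst Unique (sym (allFillings≡ r rs))
    (Unique.cartesianProductWith⁺ _∷_ ∷-injective (allLists⁺ xs! r) (allFillings⁺ xs! rs))

Tableau : Set a → Set a
Tableau A = List A × List (List A)

mapᵀ : (A → B) → Tableau A → Tableau B
mapᵀ f (m , ps) = map f m , map (map f) ps

concatMapᵀ : (A → List B) → Tableau A → Tableau B
concatMapᵀ f (m , ps) = concatMap f m , map (concatMap f) ps

flatten : Tableau A → List A
flatten (m , ps) = m ++ concat ps

-- (minus , j) is the j-th box of T⁻ and (plus k , j) the j-th box of row k of T⁺ (counted from 0).
Cell : Set
Cell = Loc × ℕ

Entry : Set a → Set a
Entry A = Cell × A

cell : Entry A → Cell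
cell = proj₁

loc : Entry A → Loc
loc = proj₁ ∘ proj₁

val : Entry A → A
val = proj₂

annotateRow : Loc → ℕ → List A → List (Entry A)
annotateRow l j []       = []
annotateRow l j (x ∷ xs) = ((l , j) , x) ∷ annotateRow l (suc j) xs

annotateRows : ℕ → List (List A) → List (List (Entry A))
annotateRows k []         = []
annotateRows k (xs ∷ xss) = annotateRow (plus k) 0 xs ∷ annotateRows (suc k) xss

annotate : Tableau A → Tableau (Entry A)
annotate (m , ps) = annotateRow minus 0 m , annotateRows 0 ps

entries : Tableau A → List (Entry A)
entries = flatten ∘ annotate

relabel : (Entry A → B) → Tableau A → Tableau B
relabel h = mapᵀ h ∘ annotate

plus-injective : ∀ {k k′} → plus k ≡ plus k′ → k ≡ k′
plus-injective refl = refl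

infix 4 _⟨_⟩=_

data _⟨_⟩=_ {A : Set a} : Tableau A → Cell → A → Set a where
  in⁻ : ∀ {m ps j x} → m [ j ]= x → (m , ps) ⟨ minus , j ⟩= x
  in⁺ : ∀ {m ps k row j x} → ps [ k ]= row → row [ j ]= x → (m , ps) ⟨ plus k , j ⟩= x

module _ {A : Set a} {B : Set b} where

  flatten-mapᵀ : ∀ (f : A → B) T → flatten (mapᵀ f T) ≡ map f (flatten T)
  flatten-mapᵀ f (m , ps) = trans (cong (map f m ++_) (concat-map ps)) (sym (map-++ f m (concat ps)))

  concat-map-concatMap : ∀ (g : A → List B) xss → concat (map (concatMap g) xss) ≡ concatMap g (concat xss)
  concat-map-concatMap g []         = refl
  concat-map-concatMap g (xs ∷ xss) = trans (cong (concatMap g xs ++_) (concat-map-concatMap g xss))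
                                              (sym (concatMap-++ g xs (concat xss)))

  flatten-concatMapᵀ : ∀ (g : A → List B) T → flatten (concatMapᵀ g T) ≡ concatMap g (flatten T)
  flatten-concatMapᵀ g (m , ps) =
    trans (cong (concatMap g m ++_) (concat-map-concatMap g ps)) (sym (concatMap-++ g m (concat ps)))

  mapᵀ-cong : ∀ {f g : A → B} T → (∀ {x} → x ∈ flatten T → f x ≡ g x) → mapᵀ f T ≡ mapᵀ g T
  mapᵀ-cong (m , ps) f≡g = cong₂ _,_ (map-cong-local (All.tabulate (f≡g ∘ ∈-++⁺ˡ)))
    (map-cong-local (All.tabulate λ row∈ → map-cong-local (All.tabulate λ x∈ →
      f≡g (∈-++⁺ʳ m (∈-concat⁺′ x∈ row∈)))))

  mapᵀ-injective : ∀ {f : A → B} → (∀ {x y} → f x ≡ f y → x ≡ y) → ∀ {T T′} → mapᵀ f T ≡ mapᵀ f T′ → T ≡ T′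
  mapᵀ-injective f-inj {m , ps} {m′ , ps′} eq =
    cong₂ _,_ (map-injective f-inj (cong proj₁ eq)) (map-injective (map-injective f-inj) (cong proj₂ eq))

  mapᵀ-concatMapᵀ : ∀ {c} {C : Set c} (q : B → C) (g : A → List B) (h : A → C) T →
    (∀ {x} → x ∈ flatten T → map q (g x) ≡ [ h x ]) → mapᵀ q (concatMapᵀ g T) ≡ mapᵀ h T
  mapᵀ-concatMapᵀ q g h (m , ps) qg≡h = cong₂ _,_ (row (qg≡h ∘ ∈-++⁺ˡ))
    (trans (sym (map-∘ ps)) (map-cong-local (All.tabulate λ row∈ → row λ x∈ → qg≡h (∈-++⁺ʳ m (∈-concat⁺′ x∈ row∈)))))
    where
      row : ∀ {xs} → (∀ {x} → x ∈ xs → map q (g x) ≡ [ h x ]) → map q (concatMap g xs) ≡ map h xs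
      row {[]}     _     = refl
      row {x ∷ xs} qg≡h′ = trans (map-++ q (g x) (concatMap g xs)) (cong₂ _++_ (qg≡h′ (here refl)) (row (qg≡h′ ∘ there)))

mapᵀ-∘ : ∀ {c} {C : Set c} (g : B → C) (f : A → B) T → mapᵀ g (mapᵀ f T) ≡ mapᵀ (g ∘ f) T
mapᵀ-∘ g f (m , ps) = cong₂ _,_ (sym (map-∘ m)) (trans (sym (map-∘ ps)) (map-cong (λ row → sym (map-∘ row)) ps))

mapᵀ-id : ∀ (T : Tableau A) → mapᵀ id T ≡ T
mapᵀ-id (m , ps) = cong₂ _,_ (map-id m) (trans (map-cong map-id ps) (map-id ps))

concatMapᵀ-mapᵀ : ∀ {c} {C : Set c} (g : B → List C) (f : A → B) T → concatMapᵀ g (mapᵀ f T) ≡ concatMapᵀ (g ∘ f) T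
concatMapᵀ-mapᵀ g f (m , ps) = cong₂ _,_ (concatMap-map g f m)
  (trans (sym (map-∘ ps)) (map-cong (concatMap-map g f) ps))

relabelEntry : (Entry A → B) → Entry A → Entry B
relabelEntry h e = cell e , h e

module _ {A : Set a} where

  mapᵀ-val-annotate : ∀ (T : Tableau A) → mapᵀ val (annotate T) ≡ T
  mapᵀ-val-annotate (m , ps) = cong₂ _,_ (row minus 0 m) (rows 0 ps)
    where
      row : ∀ l j (xs : List A) → map val (annotateRow l j xs) ≡ xs
      row l j []       = refl
      row l j (x ∷ xs) = cong (x ∷_) (row l (suc j) xs)
      rows : ∀ k (xss : List (List A)) → map (map val) (annotateRows k xss) ≡ xss
      rows k []         = refl
      rows k (xs ∷ xss) = cong₂ _∷_ (row (plus k) 0 xs) (rows (suc k) xss)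

  annotate-relabel : ∀ (h : Entry A → B) T → annotate (relabel h T) ≡ mapᵀ (relabelEntry h) (annotate T)
  annotate-relabel h (m , ps) = cong₂ _,_ (row minus 0 m) (rows 0 ps)
    where
      row : ∀ l j (xs : List A) → annotateRow l j (map h (annotateRow l j xs)) ≡ map (relabelEntry h) (annotateRow l j xs)
      row l j []       = refl
      row l j (x ∷ xs) = cong (_ ∷_) (row l (suc j) xs)
      rows : ∀ k (xss : List (List A)) →
             annotateRows k (map (map h) (annotateRows k xss)) ≡ map (map (relabelEntry h)) (annotateRows k xss)
      rows k []         = refl
      rows k (xs ∷ xss) = cong₂ _∷_ (row (plus k) 0 xs) (rows (suc k) xss)

  ∈-annotateRow⁻ : ∀ {l j xs c} {x : A} → (c , x) ∈ annotateRow l j xs → ∃ λ i → c ≡ (l , j + i) × xs [ i ]= x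
  ∈-annotateRow⁻ {l} {j} {_ ∷ _} (here refl) = 0 , cong (l ,_) (sym (+-identityʳ j)) , here
  ∈-annotateRow⁻ {l} {j} {_ ∷ _} (there e∈) with i , refl , xs[i] ← ∈-annotateRow⁻ e∈ =
    suc i , cong (l ,_) (sym (+-suc j i)) , there xs[i]

  ∈-annotateRow⁺ : ∀ {l j xs i} {x : A} → xs [ i ]= x → ((l , j + i) , x) ∈ annotateRow l j xs
  ∈-annotateRow⁺ {j = j} here rewrite +-identityʳ j = here refl
  ∈-annotateRow⁺ {l} {j} {_ ∷ xs} {suc i} {x} (there xs[i]) =
    there (subst (λ c → ((l , c) , x) ∈ annotateRow l (suc j) xs) (sym (+-suc j i)) (∈-annotateRow⁺ xs[i]))

  ∈-annotateRows⁻ : ∀ {k xss} {e : Entry A} → e ∈ concat (annotateRows k xss) →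
                    ∃ λ i → ∃ λ row → xss [ i ]= row × e ∈ annotateRow (plus (k + i)) 0 row
  ∈-annotateRows⁻ {k} {xs ∷ xss} {e} e∈ with ∈-++⁻ (annotateRow (plus k) 0 xs) e∈
  ... | inj₁ e∈xs  = 0 , xs , here , subst (λ k′ → e ∈ annotateRow (plus k′) 0 xs) (sym (+-identityʳ k)) e∈xs
  ... | inj₂ e∈xss = let i , row , xss[i] , e∈row = ∈-annotateRows⁻ e∈xss in
    suc i , row , there xss[i] , subst (λ k′ → e ∈ annotateRow (plus k′) 0 row) (sym (+-suc k i)) e∈row

  ∈-annotateRows⁺ : ∀ {k xss i row} {e : Entry A} → xss [ i ]= row → e ∈ annotateRow (plus (k + i)) 0 row →
                    e ∈ concat (annotateRows k xss)
  ∈-annotateRows⁺ {k} {row = row} {e} here e∈ =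
    ∈-++⁺ˡ (subst (λ k′ → e ∈ annotateRow (plus k′) 0 row) (+-identityʳ k) e∈)
  ∈-annotateRows⁺ {k} {xs ∷ _} {suc i} {row} {e} (there xss[i]) e∈ =
    ∈-++⁺ʳ (annotateRow (plus k) 0 xs) (∈-annotateRows⁺ xss[i] (subst (λ k′ → e ∈ annotateRow (plus k′) 0 row) (+-suc k i) e∈))

  ∈-entries⁻ : ∀ {T : Tableau A} {c x} → (c , x) ∈ entries T → T ⟨ c ⟩= x
  ∈-entries⁻ {m , ps} e∈ with ∈-++⁻ (annotateRow minus 0 m) e∈
  ... | inj₁ e∈m  = let _ , c≡ , m[j] = ∈-annotateRow⁻ e∈m in subst (_ ⟨_⟩= _) (sym c≡) (in⁻ m[j])
  ... | inj₂ e∈ps = let _ , _ , ps[k] , e∈row = ∈-annotateRows⁻ e∈ps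
                        _ , c≡ , row[j] = ∈-annotateRow⁻ e∈row
                    in subst (_ ⟨_⟩= _) (sym c≡) (in⁺ ps[k] row[j])

  ∈-entries⁺ : ∀ {T : Tableau A} {c x} → T ⟨ c ⟩= x → (c , x) ∈ entries T
  ∈-entries⁺ {m , ps} (in⁻ m[j])        = ∈-++⁺ˡ (∈-annotateRow⁺ m[j])
  ∈-entries⁺ {m , ps} (in⁺ ps[k] row[j]) = ∈-++⁺ʳ (annotateRow minus 0 m) (∈-annotateRows⁺ ps[k] (∈-annotateRow⁺ row[j]))

  ⟨⟩=-functional : ∀ {T : Tableau A} {c x y} → T ⟨ c ⟩= x → T ⟨ c ⟩= y → x ≡ y
  ⟨⟩=-functional (in⁻ m[j])        (in⁻ m[j]′)         = []=-functional m[j] m[j]′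
  ⟨⟩=-functional (in⁺ ps[k] row[j]) (in⁺ ps[k]′ row[j]′) with refl ← []=-functional ps[k] ps[k]′ = []=-functional row[j] row[j]′

  loc-annotateRow : ∀ {l j xs} {e : Entry A} → e ∈ annotateRow l j xs → loc e ≡ l
  loc-annotateRow {e = c , x} e∈ with _ , refl , _ ← ∈-annotateRow⁻ e∈ = refl

  loc-annotateRows : ∀ {k xss} {e : Entry A} → e ∈ concat (annotateRows k xss) → ∃ λ i → loc e ≡ plus (k + i)
  loc-annotateRows {k} {xss} e∈ = let i , _ , _ , e∈row = ∈-annotateRows⁻ {k} {xss} e∈ in i , loc-annotateRow e∈row

  entries-unique : ∀ (T : Tableau A) → Unique (entries T)
  entries-unique (m , ps) = AllPairs.map (_∘ cong cell) (AllPairsₚ.++⁺ (row minus 0 m) (rows 0 ps)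
    (All.tabulate λ e∈m → All.tabulate λ e′∈ps eq →
      minus≢plus (trans (sym (loc-annotateRow e∈m)) (trans (cong proj₁ eq) (proj₂ (loc-annotateRows {0} {ps} e′∈ps))))))
    where
      _≢ᶜ_ : Entry A → Entry A → Set
      e ≢ᶜ e′ = cell e ≢ cell e′
      minus≢plus : ∀ {k} → minus ≢ plus k
      minus≢plus ()
      row : ∀ l j xs → AllPairs _≢ᶜ_ (annotateRow l j xs)
      row l j []       = []
      row l j (x ∷ xs) = All.tabulate later ∷ row l (suc j) xs
        where
          later : ∀ {e} → e ∈ annotateRow l (suc j) xs → (l , j) ≢ cell e
          later {c , y} e∈ eq with _ , refl , _ ← ∈-annotateRow⁻ e∈ = m≢1+m+n j (cong proj₂ eq)
      rows : ∀ k xss → AllPairs _≢ᶜ_ (concat (annotateRows k xss))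
      rows k []         = []
      rows k (xs ∷ xss) = AllPairsₚ.++⁺ (row (plus k) 0 xs) (rows (suc k) xss)
        (All.tabulate λ e∈xs → All.tabulate λ e′∈xss eq →
          m≢1+m+n k (plus-injective (trans (sym (loc-annotateRow e∈xs))
                                           (trans (cong proj₁ eq) (proj₂ (loc-annotateRows {suc k} {xss} e′∈xss))))))

map-val-entries : ∀ (T : Tableau A) → map val (entries T) ≡ flatten T
map-val-entries T = trans (sym (flatten-mapᵀ val (annotate T))) (cong flatten (mapᵀ-val-annotate T))

module _ {A : Set a} {B : Set b} where

  entries-relabel : ∀ (h : Entry A → B) T → entries (relabel h T) ≡ map (relabelEntry h) (entries T)
  entries-relabel h T = trans (cong flatten (annotate-relabel h T)) (flatten-mapᵀ (relabelEntry h) (annotate T))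

  ∈-entries-relabel⁻ : ∀ (h : Entry A → B) T {e} → e ∈ entries (relabel h T) → ∃ λ e₀ → e₀ ∈ entries T × e ≡ relabelEntry h e₀
  ∈-entries-relabel⁻ h T e∈ = ∈-map⁻ (relabelEntry h) (subst (_ ∈_) (entries-relabel h T) e∈)

  relabel-cong : ∀ {h h′ : Entry A → B} T → (∀ {e} → e ∈ entries T → h e ≡ h′ e) → relabel h T ≡ relabel h′ T
  relabel-cong T = mapᵀ-cong (annotate T)

  mapᵀ≡relabel : ∀ (f : A → B) T → mapᵀ f T ≡ relabel (f ∘ val) T
  mapᵀ≡relabel f T = trans (cong (mapᵀ f) (sym (mapᵀ-val-annotate T))) (mapᵀ-∘ f val (annotate T))

  relabel-relabel : ∀ {c} {C : Set c} (h : Entry A → B) (h′ : Entry B → C) T →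
                    relabel h′ (relabel h T) ≡ relabel (h′ ∘ relabelEntry h) T
  relabel-relabel h h′ T = trans (cong (mapᵀ h′) (annotate-relabel h T)) (mapᵀ-∘ h′ (relabelEntry h) (annotate T))

⟨⟩=-relabel⁻ : ∀ (h : Entry A → B) (T : Tableau A) {c y} → relabel h T ⟨ c ⟩= y → ∃ λ x → T ⟨ c ⟩= x × y ≡ h (c , x)
⟨⟩=-relabel⁻ h T T[c] with (c , x) , e∈ , refl ← ∈-entries-relabel⁻ h T (∈-entries⁺ T[c]) = x , ∈-entries⁻ e∈ , refl

shape : Tableau A → ℕ × List ℕ
shape (m , ps) = length m , map length ps

shape-mapᵀ : ∀ (f : A → B) T → shape (mapᵀ f T) ≡ shape T
shape-mapᵀ f (m , ps) = cong₂ _,_ (length-map f m) (trans (sym (map-∘ ps)) (map-cong (length-map f) ps))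

shape-annotate : ∀ (T : Tableau A) → shape (annotate T) ≡ shape T
shape-annotate T = trans (sym (shape-mapᵀ val (annotate T))) (cong shape (mapᵀ-val-annotate T))

shape-relabel : ∀ (h : Entry A → B) T → shape (relabel h T) ≡ shape T
shape-relabel h T = trans (shape-mapᵀ h (annotate T)) (shape-annotate T)

length-flatten : ∀ {p ls} (T : Tableau A) → shape T ≡ (p , ls) → length (flatten T) ≡ sum ls + p
length-flatten (m , ps) refl = trans (length-++ m) (trans (cong (length m +_) (length-concat ps)) (+-comm (length m) _))
  where
    length-concat : ∀ (xss : List (List A)) → length (concat xss) ≡ sum (map length xss)
    length-concat []         = refl
    length-concat (xs ∷ xss) = trans (length-++ xs) (cong (length xs +_) (length-concat xss))

length-entries : ∀ (T : Tableau A) → length (entries T) ≡ length (flatten T)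
length-entries T = trans (sym (length-map val (entries T))) (cong length (map-val-entries T))

Sorted : ∀ {ℓ} → (A → A → Set ℓ) → List A → Set _
Sorted R xs = ∀ {i j x y} → xs [ i ]= x → xs [ j ]= y → i < j → R x y

module _ {ℓ} {R : A → A → Set ℓ} where

  AllPairs⇒Sorted : ∀ {xs} → AllPairs R xs → Sorted R xs
  AllPairs⇒Sorted (x≺xs ∷ _)   here       (there xs[j]) _         = All.lookup x≺xs ([]=⇒∈ xs[j])
  AllPairs⇒Sorted (_    ∷ xs↗) (there p) (there q)     (s≤s i<j) = AllPairs⇒Sorted xs↗ p q i<j

  Sorted⇒Linked : ∀ {xs} → Sorted R xs → Linked R xs
  Sorted⇒Linked {[]}         _  = []
  Sorted⇒Linked {x ∷ []}     _  = [-]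
  Sorted⇒Linked {x ∷ y ∷ xs} xs↗ =
    xs↗ here (there here) (s≤s z≤n) ∷ Sorted⇒Linked (λ p q i<j → xs↗ (there p) (there q) (s≤s i<j))

  Linked-adjacent : ∀ {xs i x y} → Linked R xs → xs [ i ]= x → xs [ suc i ]= y → R x y
  Linked-adjacent (Rxy ∷ _)  here      (there here) = Rxy
  Linked-adjacent (_   ∷ xs↗) (there p) (there q)   = Linked-adjacent xs↗ p q

  adjacent⇒Linked : ∀ {xs} → (∀ {i x y} → xs [ i ]= x → xs [ suc i ]= y → R x y) → Linked R xs
  adjacent⇒Linked {[]}         _   = []
  adjacent⇒Linked {x ∷ []}     _   = [-]
  adjacent⇒Linked {x ∷ y ∷ xs} adj = adj here (there here) ∷ adjacent⇒Linked (λ p q → adj (there p) (there q))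

Linked⇒Sorted : ∀ {ℓ} {R : A → A → Set ℓ} → (∀ {x y z} → R x y → R y z → R x z) → ∀ {xs} → Linked R xs → Sorted R xs
Linked⇒Sorted R-trans = AllPairs⇒Sorted ∘ Linkedₚ.Linked⇒AllPairs R-trans

Linked-≤-mono : ∀ {s i j x y} → Linked _≤_ s → s [ i ]= x → s [ j ]= y → i ≤ j → x ≤ y
Linked-≤-mono s↗ p q i≤j with m≤n⇒m<n∨m≡n i≤j
... | inj₁ i<j  = Linked⇒Sorted ≤-trans s↗ p q i<j
... | inj₂ refl = ≤-reflexive ([]=-functional p q)

module _ {ℓ} (R : A → A → Set ℓ) where

  Rows : Tableau A → Set _
  Rows T = ∀ {l j j′ x y} → T ⟨ l , j ⟩= x → T ⟨ l , j′ ⟩= y → j < j′ → R x y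

  Columns : Tableau A → Set _
  Columns T = ∀ {k j x y} → T ⟨ plus k , j ⟩= x → T ⟨ plus (suc k) , j ⟩= y → R x y

  Rows⇒Linked : ∀ {m ps} → Rows (m , ps) → Linked R m × All (Linked R) ps
  Rows⇒Linked rows = Sorted⇒Linked (λ p q → rows (in⁻ p) (in⁻ q)) ,
    All.tabulate λ row∈ → let _ , ps[k] = ∈⇒[]= row∈ in Sorted⇒Linked λ p q → rows (in⁺ ps[k] p) (in⁺ ps[k] q)

  Linked⇒Rows : (∀ {x y z} → R x y → R y z → R x z) → ∀ {m ps} → Linked R m → All (Linked R) ps → Rows (m , ps)
  Linked⇒Rows R-trans m↗ ps↗ (in⁻ p)       (in⁻ q)        = Linked⇒Sorted R-trans m↗ p q
  Linked⇒Rows R-trans m↗ ps↗ (in⁺ ps[k] p) (in⁺ ps[k]′ q) with refl ← []=-functional ps[k] ps[k]′ =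
    Linked⇒Sorted R-trans (All.lookup ps↗ ([]=⇒∈ ps[k])) p q

  Below : List A → List A → Set _
  Below r r′ = All (λ xy → R (proj₁ xy) (proj₂ xy)) (zip r r′)

  Columns⇒Linked : ∀ {m ps} → Columns (m , ps) → Linked Below ps
  Columns⇒Linked cols = adjacent⇒Linked λ ps[k] ps[k+1] → All.tabulate λ xy∈ →
    let _ , zip[j] = ∈⇒[]= xy∈ ; r[j] , r′[j] = zip-[]=⁻ _ _ zip[j] in cols (in⁺ ps[k] r[j]) (in⁺ ps[k+1] r′[j])

  Linked⇒Columns : ∀ {m ps} → Linked Below ps → Columns (m , ps)
  Linked⇒Columns ps↓ (in⁺ ps[k] r[j]) (in⁺ ps[k+1] r′[j]) =
    All.lookup (Linked-adjacent ps↓ ps[k] ps[k+1]) ([]=⇒∈ (zip-[]=⁺ r[j] r′[j]))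

module _ {A : Set a} {B : Set b} (f : A → B) where

  ⟨⟩=-mapᵀ⁺ : ∀ {T c x} → T ⟨ c ⟩= x → mapᵀ f T ⟨ c ⟩= f x
  ⟨⟩=-mapᵀ⁺ (in⁻ m[j])        = in⁻ (map-[]=⁺ f m[j])
  ⟨⟩=-mapᵀ⁺ (in⁺ ps[k] row[j]) = in⁺ (map-[]=⁺ (map f) ps[k]) (map-[]=⁺ f row[j])

  ⟨⟩=-mapᵀ⁻ : ∀ {T c y} → mapᵀ f T ⟨ c ⟩= y → ∃ λ x → T ⟨ c ⟩= x × y ≡ f x
  ⟨⟩=-mapᵀ⁻ (in⁻ m[j]) = let x , m[j]′ , y≡ = map-[]=⁻ f m[j] in x , in⁻ m[j]′ , y≡
  ⟨⟩=-mapᵀ⁻ (in⁺ ps[k] row[j]) with _ , ps[k]′ , refl ← map-[]=⁻ (map f) ps[k] =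
    let x , row[j]′ , y≡ = map-[]=⁻ f row[j] in x , in⁺ ps[k]′ row[j]′ , y≡

  module _ {ℓ} {R : B → B → Set ℓ} where

    Rows-mapᵀ⁺ : ∀ {T} → Rows (λ x y → R (f x) (f y)) T → Rows R (mapᵀ f T)
    Rows-mapᵀ⁺ rows p q j<j′ with _ , p′ , refl ← ⟨⟩=-mapᵀ⁻ p | _ , q′ , refl ← ⟨⟩=-mapᵀ⁻ q = rows p′ q′ j<j′

    Rows-mapᵀ⁻ : ∀ {T} → Rows R (mapᵀ f T) → Rows (λ x y → R (f x) (f y)) T
    Rows-mapᵀ⁻ rows p q = rows (⟨⟩=-mapᵀ⁺ p) (⟨⟩=-mapᵀ⁺ q)

    Columns-mapᵀ⁺ : ∀ {T} → Columns (λ x y → R (f x) (f y)) T → Columns R (mapᵀ f T)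
    Columns-mapᵀ⁺ cols p q with _ , p′ , refl ← ⟨⟩=-mapᵀ⁻ p | _ , q′ , refl ← ⟨⟩=-mapᵀ⁻ q = cols p′ q′

    Columns-mapᵀ⁻ : ∀ {T} → Columns R (mapᵀ f T) → Columns (λ x y → R (f x) (f y)) T
    Columns-mapᵀ⁻ cols p q = cols (⟨⟩=-mapᵀ⁺ p) (⟨⟩=-mapᵀ⁺ q)

module _ {K : ℕ} where

  weakRow⇒Linked : ∀ (xs : List (Fin K)) → T (weakRow xs) → Linked Fin._≤_ xs
  weakRow⇒Linked []           _ = []
  weakRow⇒Linked (_ ∷ [])     _ = [-]
  weakRow⇒Linked (a ∷ b ∷ xs) t = let a≤b , t′ = Equivalence.to T-∧ t in toWitness a≤b ∷ weakRow⇒Linked (b ∷ xs) t′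

  Linked⇒weakRow : ∀ {xs : List (Fin K)} → Linked Fin._≤_ xs → T (weakRow xs)
  Linked⇒weakRow []          = _
  Linked⇒weakRow [-]         = _
  Linked⇒weakRow (a≤b ∷ xs↗) = Equivalence.from T-∧ (fromWitness a≤b , Linked⇒weakRow xs↗)

  strictRow⇒Linked : ∀ (xs : List (Fin K)) → T (strictRow xs) → Linked Fin._<_ xs
  strictRow⇒Linked []           _ = []
  strictRow⇒Linked (_ ∷ [])     _ = [-]
  strictRow⇒Linked (a ∷ b ∷ xs) t = let a<b , t′ = Equivalence.to T-∧ t in toWitness a<b ∷ strictRow⇒Linked (b ∷ xs) t′

  Linked⇒strictRow : ∀ {xs : List (Fin K)} → Linked Fin._<_ xs → T (strictRow xs)
  Linked⇒strictRow []          = _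
  Linked⇒strictRow [-]         = _
  Linked⇒strictRow (a<b ∷ xs↗) = Equivalence.from T-∧ (fromWitness a<b , Linked⇒strictRow xs↗)

  strictCols⇒Linked : ∀ (rs : List (List (Fin K))) → T (strictCols rs) → Linked (Below Fin._<_) rs
  strictCols⇒Linked []             _ = []
  strictCols⇒Linked (_ ∷ [])       _ = [-]
  strictCols⇒Linked (r ∷ r′ ∷ rs)  t = let below , t′ = Equivalence.to T-∧ t in
    All.map toWitness (Allₚ.all⁺ _ (zip r r′) below) ∷ strictCols⇒Linked (r′ ∷ rs) t′

  Linked⇒strictCols : ∀ {rs : List (List (Fin K))} → Linked (Below Fin._<_) rs → T (strictCols rs)
  Linked⇒strictCols []           = _
  Linked⇒strictCols [-]          = _
  Linked⇒strictCols (below ∷ rs↓) = Equivalence.from T-∧ (Allₚ.all⁻ _ (All.map fromWitness below) , Linked⇒strictCols rs↓)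

  distinct⇒Unique : ∀ (xs : List (Fin K)) → T (distinct xs) → Unique xs
  distinct⇒Unique []       _ = []
  distinct⇒Unique (a ∷ xs) t = let fresh , t′ = Equivalence.to T-∧ t in fresh⇒All xs fresh ∷ distinct⇒Unique xs t′
    where
      fresh⇒All : ∀ ys → T (not (any (λ b → ⌊ a Fin.≟ b ⌋) ys)) → All (a ≢_) ys
      fresh⇒All []       _ = []
      fresh⇒All (b ∷ ys) t with a Fin.≟ b
      ... | yes _   = ⊥-elim t
      ... | no a≢b = a≢b ∷ fresh⇒All ys t

  Unique⇒distinct : ∀ {xs : List (Fin K)} → Unique xs → T (distinct xs)
  Unique⇒distinct {[]}     []          = _
  Unique⇒distinct {a ∷ xs} (a∉ ∷ xs!) = Equivalence.from T-∧ (All⇒fresh a∉ , Unique⇒distinct xs!)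
    where
      All⇒fresh : ∀ {ys} → All (a ≢_) ys → T (not (any (λ b → ⌊ a Fin.≟ b ⌋) ys))
      All⇒fresh {[]}     []           = _
      All⇒fresh {b ∷ ys} (a≢b ∷ a∉ys) with a Fin.≟ b
      ... | yes a≡b = a≢b a≡b
      ... | no  _   = All⇒fresh a∉ys

Semistandard : Tableau ℕ → Set
Semistandard U = Rows _≤_ U × Columns _<_ U

Standard : Tableau ℕ → Set
Standard V = Rows _<_ V × Columns _<_ V × Unique (flatten V)

allTableaux : ∀ {K} → ℕ → List ℕ → List (Tableau (Fin K))
allTableaux {K} p ls = cartesianProduct (allLists (allFin K) p) (allFillings (allFin K) ls)

module _ {K : ℕ} where

  ∈-allTableaux⁻ : ∀ {p ls} {S : Tableau (Fin K)} → S ∈ allTableaux p ls → shape S ≡ (p , ls)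
  ∈-allTableaux⁻ {p} {ls} S∈ = let m∈ , ps∈ = ∈-cartesianProduct⁻ (allLists (allFin K) p) _ S∈ in
    cong₂ _,_ (proj₁ (∈-allLists⁻ (allFin K) p m∈)) (lengths (∈-allFillings⁻ (allFin K) ls ps∈))
    where
      lengths : ∀ {ps ls} → FillingOf (allFin K) ps ls → map length ps ≡ ls
      lengths []               = refl
      lengths ((|r| , _) ∷ ps) = cong₂ _∷_ |r| (lengths ps)

  ∈-allTableaux⁺ : ∀ {p ls} (S : Tableau (Fin K)) → shape S ≡ (p , ls) → S ∈ allTableaux p ls
  ∈-allTableaux⁺ (m , ps) refl =
    ∈-cartesianProduct⁺ (∈-allLists⁺ (allFin K) (everywhere m)) (∈-allFillings⁺ (allFin K) (filling ps))
    where
      everywhere : ∀ (xs : List (Fin K)) → All (_∈ allFin K) xs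
      everywhere xs = All.tabulate λ {x} _ → ∈-allFin x
      filling : ∀ ps → FillingOf (allFin K) ps (map length ps)
      filling []       = []
      filling (r ∷ ps) = (refl , everywhere r) ∷ filling ps

  allTableaux-unique : ∀ p ls → Unique (allTableaux {K} p ls)
  allTableaux-unique p ls =
    Unique.cartesianProduct⁺ (allLists⁺ (allFin K) (Unique.allFin⁺ K) p) (allFillings⁺ (allFin K) (Unique.allFin⁺ K) ls)

  ∈-SSBT⁻ : ∀ {p ls S} → S ∈ SSBT K p ls → shape S ≡ (p , ls) × Semistandard (mapᵀ toℕ S)
  ∈-SSBT⁻ {p} {ls} {m , ps} S∈ =
    let S∈′ , t = ∈-filter⁻ _ {xs = allTableaux p ls} S∈
        tm , t′ = Equivalence.to T-∧ t
        tps , tcols = Equivalence.to T-∧ t′ in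
    ∈-allTableaux⁻ S∈′ ,
    Rows-mapᵀ⁺ toℕ (Linked⇒Rows _ ≤-trans (weakRow⇒Linked m tm) (All.map (weakRow⇒Linked _) (Allₚ.all⁺ _ ps tps))) ,
    Columns-mapᵀ⁺ toℕ (Linked⇒Columns _ (strictCols⇒Linked ps tcols))

  ∈-SSBT⁺ : ∀ {p ls} S → shape S ≡ (p , ls) → Semistandard (mapᵀ toℕ S) → S ∈ SSBT K p ls
  ∈-SSBT⁺ (m , ps) shapeS (rows , cols) =
    let m↗ , ps↗ = Rows⇒Linked _ (Rows-mapᵀ⁻ toℕ rows) in
    ∈-filter⁺ _ (∈-allTableaux⁺ (m , ps) shapeS) (Equivalence.from T-∧ (Linked⇒weakRow m↗ ,
      Equivalence.from T-∧ (Allₚ.all⁻ _ (All.map Linked⇒weakRow ps↗) ,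
        Linked⇒strictCols (Columns⇒Linked _ (Columns-mapᵀ⁻ toℕ cols)))))

  SSBT-unique : ∀ p ls → Unique (SSBT K p ls)
  SSBT-unique p ls = Unique.filter⁺ _ (allTableaux-unique p ls)

module _ {p : ℕ} {ls : List ℕ} where

  ∈-SBT⁻ : ∀ {S} → S ∈ SBT p ls → shape S ≡ (p , ls) × Standard (mapᵀ toℕ S)
  ∈-SBT⁻ {m , ps} S∈ =
    let S∈′ , t = ∈-filter⁻ _ {xs = allTableaux p ls} S∈
        tm , t′ = Equivalence.to T-∧ t
        tps , t″ = Equivalence.to T-∧ t′
        tcols , tdist = Equivalence.to T-∧ t″ in
    ∈-allTableaux⁻ S∈′ ,
    Rows-mapᵀ⁺ toℕ (Linked⇒Rows _ <-trans (strictRow⇒Linked m tm) (All.map (strictRow⇒Linked _) (Allₚ.all⁺ _ ps tps))) ,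
    Columns-mapᵀ⁺ toℕ (Linked⇒Columns _ (strictCols⇒Linked ps tcols)) ,
    subst Unique (sym (flatten-mapᵀ toℕ (m , ps))) (Unique.map⁺ toℕ-injective (distinct⇒Unique (m ++ concat ps) tdist))

  ∈-SBT⁺ : ∀ S → shape S ≡ (p , ls) → Standard (mapᵀ toℕ S) → S ∈ SBT p ls
  ∈-SBT⁺ (m , ps) shapeS (rows , cols , flat!) =
    let m↗ , ps↗ = Rows⇒Linked _ (Rows-mapᵀ⁻ toℕ rows) in
    ∈-filter⁺ _ (∈-allTableaux⁺ (m , ps) shapeS) (Equivalence.from T-∧ (Linked⇒strictRow m↗ ,
      Equivalence.from T-∧ (Allₚ.all⁻ _ (All.map Linked⇒strictRow ps↗) ,
        Equivalence.from T-∧ (Linked⇒strictCols (Columns⇒Linked _ (Columns-mapᵀ⁻ toℕ cols)) ,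
          Unique⇒distinct (Unique.map⁻ (subst Unique (flatten-mapᵀ toℕ (m , ps)) flat!))))))

  SBT-unique : Unique (SBT p ls)
  SBT-unique = Unique.filter⁺ _ (allTableaux-unique p ls)

-- Reading order and standardization

data _<ᴸ_ : Loc → Loc → Set where
  minus<plus : ∀ {r} → minus <ᴸ plus r
  plus<plus  : ∀ {r r′} → r′ < r → plus r <ᴸ plus r′

<ᴸ-trans : ∀ {l l′ l″} → l <ᴸ l′ → l′ <ᴸ l″ → l <ᴸ l″
<ᴸ-trans minus<plus      (plus<plus _)   = minus<plus
<ᴸ-trans (plus<plus r′<r) (plus<plus r″<r′) = plus<plus (<-trans r″<r′ r′<r)

<ᴸ-compare : Trichotomous _≡_ _<ᴸ_
<ᴸ-compare minus    minus     = tri≈ (λ ()) refl (λ ())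
<ᴸ-compare minus    (plus _)  = tri< minus<plus (λ ()) (λ ())
<ᴸ-compare (plus _) minus     = tri> (λ ()) (λ ()) minus<plus
<ᴸ-compare (plus r) (plus r′) with <-cmp r r′
... | tri< r<r′ r≢r′ _ = tri> (λ { (plus<plus r′<r) → <-asym r<r′ r′<r }) (r≢r′ ∘ plus-injective) (plus<plus r<r′)
... | tri≈ _ refl _   = tri≈ (λ { (plus<plus r<r) → <-irrefl refl r<r }) refl (λ { (plus<plus r<r) → <-irrefl refl r<r })
... | tri> _ r≢r′ r′<r = tri< (plus<plus r′<r) (r≢r′ ∘ plus-injective) (λ { (plus<plus r<r′) → <-asym r<r′ r′<r })

-- T⁻ before T⁺, lower rows of T⁺ before higher ones, and from left to right within a row.
_≺_ : Cell → Cell → Set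
_≺_ = ×-Lex _≡_ _<ᴸ_ _<_

≺-trans : ∀ {c c′ c″} → c ≺ c′ → c′ ≺ c″ → c ≺ c″
≺-trans = ×-transitive {_≈₁_ = _≡_} {_<₁_ = _<ᴸ_} {_<₂_ = _<_} ≡.isEquivalence (≡.resp₂ _<ᴸ_) <ᴸ-trans <-trans

≺-compare : Trichotomous (Pointwise _≡_ _≡_) _≺_
≺-compare = ×-compare sym <ᴸ-compare <-cmp

key : Entry ℕ → ℕ × Cell
key e = val e , cell e

_⊏_ : Entry ℕ → Entry ℕ → Set
e ⊏ e′ = ×-Lex _≡_ _<_ _≺_ (key e) (key e′)

⊏-trans : ∀ {e e′ e″} → e ⊏ e′ → e′ ⊏ e″ → e ⊏ e″
⊏-trans {e} {e′} {e″} =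
  ×-transitive {_≈₁_ = _≡_} {_<₁_ = _<_} {_<₂_ = _≺_} ≡.isEquivalence (≡.resp₂ _<_) <-trans ≺-trans {key e} {key e′} {key e″}

⊏-compare : ∀ e e′ → Tri (e ⊏ e′) (val e ≡ val e′ × Pointwise _≡_ _≡_ (cell e) (cell e′)) (e′ ⊏ e)
⊏-compare e e′ = ×-compare sym <-cmp ≺-compare (key e) (key e′)

_⊏?_ : ∀ e e′ → Dec (e ⊏ e′)
e ⊏? e′ = tri⇒dec< (×-compare sym <-cmp ≺-compare) (key e) (key e′)

⊏-irrefl : ∀ {e} → ¬ e ⊏ e
⊏-irrefl {e} with ⊏-compare e e
... | tri< _ _ ¬e⊏e = ¬e⊏e
... | tri≈ ¬e⊏e _ _ = ¬e⊏e
... | tri> ¬e⊏e _ _ = ¬e⊏e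

entry-≡ : ∀ {e e′ : Entry ℕ} → val e ≡ val e′ → Pointwise _≡_ _≡_ (cell e) (cell e′) → e ≡ e′
entry-≡ v≡ c≡ = cong₂ _,_ (≡×≡⇒≡ c≡) v≡

rank : Tableau ℕ → Entry ℕ → ℕ
rank U e = count (_⊏? e) (entries U)

module _ (U : Tableau ℕ) where

  rank-mono : ∀ {e e′} → e ∈ entries U → e ⊏ e′ → rank U e < rank U e′
  rank-mono e∈ e⊏e′ = count-strict (_⊏? _) (_⊏? _) (entries U) (λ _ e″⊏e → ⊏-trans e″⊏e e⊏e′) e∈ e⊏e′ ⊏-irrefl

  rank-<length : ∀ {e} → e ∈ entries U → rank U e < length (entries U)
  rank-<length e∈ = count-<length (_⊏? _) e∈ ⊏-irrefl

  rank-<⇒⊏ : ∀ {e e′} → e ∈ entries U → e′ ∈ entries U → rank U e < rank U e′ → e ⊏ e′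
  rank-<⇒⊏ {e} {e′} e∈ e′∈ r<r′ with ⊏-compare e e′
  ... | tri< e⊏e′ _ _     = e⊏e′
  ... | tri≈ _ (v≡ , c≡) _ = ⊥-elim (<-irrefl (cong (rank U) (entry-≡ v≡ c≡)) r<r′)
  ... | tri> _ _ e′⊏e     = ⊥-elim (<-asym r<r′ (rank-mono e′∈ e′⊏e))

  rank-injective : ∀ {e e′} → e ∈ entries U → e′ ∈ entries U → rank U e ≡ rank U e′ → e ≡ e′
  rank-injective {e} {e′} e∈ e′∈ r≡r′ with ⊏-compare e e′
  ... | tri< e⊏e′ _ _     = ⊥-elim (<-irrefl r≡r′ (rank-mono e∈ e⊏e′))
  ... | tri≈ _ (v≡ , c≡) _ = entry-≡ v≡ c≡
  ... | tri> _ _ e′⊏e     = ⊥-elim (<-irrefl (sym r≡r′) (rank-mono e′∈ e′⊏e))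

-- Compositions and compatible sequences

-- With labels t and t + 1 at locations l and l′, Descent l l′ says that t ∈ D(comp T), and
-- Compatible (locations T) s says that s indexes a term of F̃ (comp T).

Descent : Loc → Loc → Set
Descent minus    _         = ⊥
Descent (plus r) minus     = ⊤
Descent (plus r) (plus r′) = r < r′

Step : Loc × ℕ → Loc × ℕ → Set
Step (l , a) (l′ , b) = a ≤ b × (Descent l l′ → a < b)

Compatible : List Loc → List ℕ → Set
Compatible ls s = Linked Step (zip ls s)

Compatible⇒Linked : ∀ {ls s} → length ls ≡ length s → Compatible ls s → Linked _≤_ s
Compatible⇒Linked {[]}         {[]}         _  _                 = []
Compatible⇒Linked {_ ∷ []}     {_ ∷ []}     _  _                 = [-]
Compatible⇒Linked {_ ∷ _ ∷ _}  {_ ∷ _ ∷ _}  eq ((a≤b , _) ∷ rest) = a≤b ∷ Compatible⇒Linked (suc-injective eq) rest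

adjacent⇒Compatible : ∀ {ls s} →
  (∀ {t l l′ a b} → ls [ t ]= l → ls [ suc t ]= l′ → s [ t ]= a → s [ suc t ]= b → Step (l , a) (l′ , b)) →
  Compatible ls s
adjacent⇒Compatible step = adjacent⇒Linked λ p q → let ls[t] , s[t] = zip-[]=⁻ _ _ p ; ls[t+1] , s[t+1] = zip-[]=⁻ _ _ q in
  step ls[t] ls[t+1] s[t] s[t+1]

-- Along a stretch of equal values, the labels of a standard tableau climb weakly upwards through T⁺.
Compatible-plateau : ∀ {ls s t t′ a r l′} → length ls ≡ length s → Compatible ls s → t ≤ t′ →
  s [ t ]= a → s [ t′ ]= a → ls [ t ]= plus r → ls [ t′ ]= l′ → ∃ λ r′ → l′ ≡ plus r′ × r′ ≤ r
Compatible-plateau {_ ∷ _} {_ ∷ _} _  _ z≤n here here here here = _ , refl , ≤-refl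
Compatible-plateau {_ ∷ _} {_ ∷ _} eq compat (s≤s t≤t′) (there p) (there q) (there x) (there y) =
  Compatible-plateau (suc-injective eq) (Linked.tail compat) t≤t′ p q x y
Compatible-plateau {plus r ∷ l′ ∷ ls} {a ∷ b ∷ s} eq ((a≤b , descent⇒a<b) ∷ compat) z≤n here (there s[t′]) here (there ls[t′])
  with b≡a ← ≤-antisym (Linked-≤-mono (Compatible⇒Linked (suc-injective eq) compat) here s[t′] z≤n) a≤b | l′
... | minus     = ⊥-elim (<-irrefl (sym b≡a) (descent⇒a<b _))
... | plus r′ with r <? r′
...   | yes r<r′ = ⊥-elim (<-irrefl (sym b≡a) (descent⇒a<b r<r′))
...   | no  r≮r′ =
  let r″ , eq″ , r″≤r′ = Compatible-plateau (suc-injective eq) compat z≤n here (subst (_ [ _ ]=_) (sym b≡a) s[t′]) here ls[t′]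
  in r″ , eq″ , ≤-trans r″≤r′ (≮⇒≥ r≮r′)


⊏⇒Step : ∀ {e e′} → e ⊏ e′ → Step (loc e , val e) (loc e′ , val e′)
⊏⇒Step (inj₁ v<v′)        = <⇒≤ v<v′ , λ _ → v<v′
⊏⇒Step {(l , _) , _} {(l′ , _) , _} (inj₂ (refl , c≺c′)) = ≤-refl , ⊥-elim ∘ no-descent l l′ c≺c′
  where
    no-descent : ∀ l l′ {j j′} → (l , j) ≺ (l′ , j′) → ¬ Descent l l′
    no-descent (plus r) (plus r′) (inj₁ (plus<plus r′<r)) r<r′ = <-asym r<r′ r′<r
    no-descent (plus r) (plus r′) (inj₂ (refl , _))        r<r′ = <-irrefl refl r<r′
    no-descent (plus r) minus     (inj₁ ())

module _ {c ℓ} (R : CommutativeSemiring c ℓ) where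
  open CommutativeSemiring R using (Carrier; 1#; _≈_)
    renaming (*-congˡ to ⊗-congˡ; *-identityˡ to ⊗-identityˡ; refl to ≈-refl; sym to ≈-sym; trans to ≈-trans)
  private
    module Π = BigOperator (CommutativeSemiring.*-commutativeMonoid R)

  kindOf : Loc → List Loc → PosKind R
  kindOf minus    _              = zpos
  kindOf (plus r) []             = dpos
  kindOf (plus r) (minus ∷ _)    = dpos
  kindOf (plus r) (plus r′ ∷ _)  = if ⌊ r <? r′ ⌋ then dpos else inner

  kindsOf : List Loc → List (PosKind R)
  kindsOf []       = []
  kindsOf (l ∷ ls) = kindOf l ls ∷ kindsOf ls

  length-kindsOf : ∀ ls → length (kindsOf ls) ≡ length ls
  length-kindsOf []       = refl
  length-kindsOf (l ∷ ls) = cong suc (length-kindsOf ls)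

  mutual
    kinds-compLocs : ∀ ls → kinds R (compLocs ls) ≡ kindsOf ls
    kinds-compLocs []            = refl
    kinds-compLocs (minus  ∷ ls) = cong (zpos ∷_) (kinds-compLocs ls)
    kinds-compLocs (plus r ∷ ls) = kinds-runLocs 0 r ls

    kinds-runLocs : ∀ s r ls → kinds R (runLocs (suc s) r ls) ≡ replicate s inner ++ kindsOf (plus r ∷ ls)
    kinds-runLocs s r []             = refl
    kinds-runLocs s r (minus   ∷ ls) = cong (λ ks → replicate s inner ++ dpos ∷ zpos ∷ ks) (kinds-compLocs ls)
    kinds-runLocs s r (plus r′ ∷ ls) with r <? r′
    ... | yes _ = cong (λ ks → replicate s inner ++ dpos ∷ ks) (kinds-runLocs 0 r′ ls)
    ... | no  _ = trans (kinds-runLocs (suc s) r′ ls) (replicate-suc s (kindsOf (plus r′ ∷ ls)))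
      where
        replicate-suc : ∀ s ks → replicate (suc s) inner ++ ks ≡ replicate s inner ++ inner ∷ ks
        replicate-suc zero    ks = refl
        replicate-suc (suc s) ks = cong (inner ∷_) (replicate-suc s ks)

  module _ {M : ℕ} where

    private
      step⁻ : ∀ l l′ ls (a b : Fin M) s → T (okSeq R (kindsOf (l ∷ l′ ∷ ls)) (a ∷ b ∷ s)) →
              Step (l , toℕ a) (l′ , toℕ b) × T (okSeq R (kindsOf (l′ ∷ ls)) (b ∷ s))
      step⁻ minus    l′        ls a b s t = let a≤b , t′ = Equivalence.to T-∧ t in (toWitness a≤b , λ ()) , t′
      step⁻ (plus r) minus     ls a b s t = let a<b , t′ = Equivalence.to T-∧ t in (<⇒≤ (toWitness a<b) , λ _ → toWitness a<b) , t′
      step⁻ (plus r) (plus r′) ls a b s t with r <? r′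
      ... | yes _    = let a<b , t′ = Equivalence.to T-∧ t in (<⇒≤ (toWitness a<b) , λ _ → toWitness a<b) , t′
      ... | no r≮r′ = let a≤b , t′ = Equivalence.to T-∧ t in (toWitness a≤b , ⊥-elim ∘ r≮r′) , t′

      step⁺ : ∀ l l′ ls (a b : Fin M) s → Step (l , toℕ a) (l′ , toℕ b) → T (okSeq R (kindsOf (l′ ∷ ls)) (b ∷ s)) →
              T (okSeq R (kindsOf (l ∷ l′ ∷ ls)) (a ∷ b ∷ s))
      step⁺ minus    l′        ls a b s (a≤b , _) t′ = Equivalence.from T-∧ (fromWitness a≤b , t′)
      step⁺ (plus r) minus     ls a b s (_ , a<b) t′ = Equivalence.from T-∧ (fromWitness (a<b _) , t′)
      step⁺ (plus r) (plus r′) ls a b s (a≤b , a<b) t′ with r <? r′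
      ... | yes r<r′ = Equivalence.from T-∧ (fromWitness (a<b r<r′) , t′)
      ... | no  _    = Equivalence.from T-∧ (fromWitness a≤b , t′)

    okSeq⇒Compatible : ∀ ls (s : List (Fin M)) → length ls ≡ length s → T (okSeq R (kindsOf ls) s) → Compatible ls (map toℕ s)
    okSeq⇒Compatible []           []          _  _ = []
    okSeq⇒Compatible (l ∷ [])     (a ∷ [])    _  _ = [-]
    okSeq⇒Compatible (l ∷ l′ ∷ ls) (a ∷ b ∷ s) eq t =
      let step , t′ = step⁻ l l′ ls a b s t in step ∷ okSeq⇒Compatible (l′ ∷ ls) (b ∷ s) (suc-injective eq) t′

    Compatible⇒okSeq : ∀ ls (s : List (Fin M)) → length ls ≡ length s → Compatible ls (map toℕ s) → T (okSeq R (kindsOf ls) s)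
    Compatible⇒okSeq []           []          _  _              = _
    Compatible⇒okSeq (minus  ∷ []) (a ∷ [])   _  _              = _
    Compatible⇒okSeq (plus _ ∷ []) (a ∷ [])   _  _              = _
    Compatible⇒okSeq (l ∷ l′ ∷ ls) (a ∷ b ∷ s) eq (step ∷ compat) =
      step⁺ l l′ ls a b s step (Compatible⇒okSeq (l′ ∷ ls) (b ∷ s) (suc-injective eq) compat)

    contribution : (Fin M → Carrier) → Loc × Fin M → Carrier
    contribution x (minus  , a) = 1#
    contribution x (plus _ , a) = x a

    weight-kindsOf : ∀ (x : Fin M → Carrier) ls s → length ls ≡ length s →
                     weight R x (kindsOf ls) s ≈ Π.⨁ (zip ls s) (contribution x)
    weight-kindsOf x []                    []      _  = ≈-refl
    weight-kindsOf x (minus ∷ ls)          (a ∷ s) eq = ≈-trans (weight-kindsOf x ls s (suc-injective eq)) (≈-sym (⊗-identityˡ _))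
    weight-kindsOf x (plus r ∷ [])         (a ∷ []) _ = ≈-refl
    weight-kindsOf x (plus r ∷ minus ∷ ls) (a ∷ s) eq = ⊗-congˡ (weight-kindsOf x (minus ∷ ls) s (suc-injective eq))
    weight-kindsOf x (plus r ∷ plus r′ ∷ ls) (a ∷ s) eq with r <? r′
    ... | yes _ = ⊗-congˡ (weight-kindsOf x (plus r′ ∷ ls) s (suc-injective eq))
    ... | no  _ = ⊗-congˡ (weight-kindsOf x (plus r′ ∷ ls) s (suc-injective eq))

tabulate-[]= : ∀ {n} (f : Fin n → A) (k : Fin n) → tabulate f [ toℕ k ]= f k
tabulate-[]= f Fin.zero    = here
tabulate-[]= f (Fin.suc k) = there (tabulate-[]= (f ∘ Fin.suc) k)

module _ {K : ℕ} where

  locations : Tableau (Fin K) → List Loc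
  locations T = map (locate T) (allFin K)

  length-locations : ∀ T → length (locations T) ≡ K
  length-locations T = trans (length-map (locate T) (allFin K)) (length-tabulate {n = K} (λ i → i))

  private
    ∈ᵇ-true : ∀ {k : Fin K} {r} → k ∈ r → (k ∈ᵇ r) ≡ true
    ∈ᵇ-true {k} {b ∷ r} k∈ with k Fin.≟ b | k∈
    ... | yes _   | _          = refl
    ... | no k≢b | here k≡b  = ⊥-elim (k≢b k≡b)
    ... | no _    | there k∈r = ∈ᵇ-true k∈r

    ∈ᵇ-false : ∀ {k : Fin K} {r} → k ∉ r → (k ∈ᵇ r) ≡ false
    ∈ᵇ-false {k} {[]}    _   = refl
    ∈ᵇ-false {k} {b ∷ r} k∉ with k Fin.≟ b
    ... | yes k≡b = ⊥-elim (k∉ (here k≡b))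
    ... | no  _   = ∈ᵇ-false (k∉ ∘ there)

    rowIndex-[]= : ∀ j {ps i row} {k : Fin K} → Unique (concat ps) → ps [ i ]= row → k ∈ row → rowIndex j ps k ≡ plus (j + i)
    rowIndex-[]= j {r ∷ ps} u here k∈ rewrite ∈ᵇ-true k∈ | +-identityʳ j = refl
    rowIndex-[]= j {r ∷ ps} {suc i} u (there ps[i]) k∈
      rewrite ∈ᵇ-false (λ k∈r → Unique-++⇒∉ {xs = r} u k∈r (∈-concat⁺′ k∈ ([]=⇒∈ ps[i]))) | +-suc j i =
        rowIndex-[]= (suc j) (Unique-++⇒Uniqueʳ {xs = r} u) ps[i] k∈

  locate-⟨⟩= : ∀ {T : Tableau (Fin K)} {l j k} → Unique (flatten T) → T ⟨ l , j ⟩= k → locate T k ≡ l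
  locate-⟨⟩= {m , ps} u (in⁻ m[j]) rewrite ∈ᵇ-true ([]=⇒∈ m[j]) = refl
  locate-⟨⟩= {m , ps} u (in⁺ ps[i] row[j])
    rewrite ∈ᵇ-false (λ k∈m → Unique-++⇒∉ {xs = m} u k∈m (∈-concat⁺′ ([]=⇒∈ row[j]) ([]=⇒∈ ps[i]))) =
      rowIndex-[]= 0 (Unique-++⇒Uniqueʳ {xs = m} u) ps[i] ([]=⇒∈ row[j])

  locations-[]= : ∀ {T : Tableau (Fin K)} {l j k} → Unique (flatten T) → T ⟨ l , j ⟩= k → locations T [ toℕ k ]= l
  locations-[]= {T} {k = k} u T[c] =
    subst (locations T [ toℕ k ]=_) (locate-⟨⟩= u T[c]) (map-[]=⁺ (locate T) (tabulate-[]= id k))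

module StandardLabels {K : ℕ} (T : Tableau (Fin K)) (|T| : length (flatten T) ≡ K) (T-std : Standard (mapᵀ toℕ T)) where

  V : Tableau ℕ
  V = mapᵀ toℕ T

  private
    flatV! : Unique (flatten V)
    flatV! = proj₂ (proj₂ T-std)

    flatV≡ : flatten V ≡ map toℕ (flatten T)
    flatV≡ = flatten-mapᵀ toℕ T

  label<K : ∀ {e} → e ∈ entries V → val e < K
  label<K e∈ = let k , _ , v≡ = ⟨⟩=-mapᵀ⁻ toℕ {T = T} (∈-entries⁻ e∈) in subst (_< K) (sym v≡) (toℕ<n k)

  labels↭ : flatten V ↭ upTo K
  labels↭ = unique-⊆-↭ flatV! (Unique.upTo⁺ K) (∈-upTo⁺ ∘ bounded)
    (≤-reflexive (trans (length-upTo K) (sym (trans (cong length flatV≡) (trans (length-map toℕ (flatten T)) |T|)))))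
    where
      bounded : ∀ {t} → t ∈ flatten V → t < K
      bounded t∈ with k , _ , refl ← ∈-map⁻ toℕ (subst (_ ∈_) flatV≡ t∈) = toℕ<n k

  label-entry : ∀ {t} → t < K → ∃ λ e → e ∈ entries V × val e ≡ t
  label-entry t<K
    with e , e∈ , t≡ ← ∈-map⁻ val (subst (_ ∈_) (sym (map-val-entries V)) (↭ₚ.Any-resp-↭ (↭-sym labels↭) (∈-upTo⁺ t<K))) =
    e , e∈ , sym t≡

  label-injective : ∀ {e e′} → e ∈ entries V → e′ ∈ entries V → val e ≡ val e′ → e ≡ e′
  label-injective = map⁻-injectiveOn val (subst Unique (sym (map-val-entries V)) flatV!)

  location-of-label : ∀ {e} → e ∈ entries V → locations T [ val e ]= loc e
  location-of-label e∈ = let _ , T[c] , v≡ = ⟨⟩=-mapᵀ⁻ toℕ {T = T} (∈-entries⁻ e∈) in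
    subst (locations T [_]= _) (sym v≡) (locations-[]= {T = T} (Unique.map⁻ (subst Unique flatV≡ flatV!)) T[c])

  count-labels : ∀ {t} → t ≤ K → count (_<? t) (flatten V) ≡ t
  count-labels {t} t≤K = trans (count-↭ (_<? t) labels↭) (trans (count<-upTo t K) (m≤n⇒m⊓n≡m t≤K))

-- Filling and standardization

-- elemAt makes the relabellings total: every label is in range, so each box receives exactly one entry.
fill : ∀ {K M} → Tableau (Fin K) × List (Fin M) → Tableau (Fin M)
fill (T , s) = concatMapᵀ (elemAt s) (mapᵀ toℕ T)

module _ {M : ℕ} where
  open import Data.List.Sort (Finₚ.≤-decTotalOrder M) using (sort; sort-↭; sort-↗) public

standardize : ∀ K {M} → Tableau (Fin M) → Tableau (Fin K) × List (Fin M)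
standardize K S = concatMapᵀ (elemAt (allFin K) ∘ rank U) (annotate U) , sort (flatten S)
  where U = mapᵀ toℕ S

module Filling {K M : ℕ} (T : Tableau (Fin K)) (|T| : length (flatten T) ≡ K) (T-std : Standard (mapᵀ toℕ T))
               (s : List (Fin M)) (|s| : length s ≡ K) (s-compat : Compatible (locations T) (map toℕ s)) where
  open StandardLabels T |T| T-std

  private
    sℕ : List ℕ
    sℕ = map toℕ s
    |sℕ| : length sℕ ≡ K
    |sℕ| = trans (length-map toℕ s) |s|
    |locations|≡|sℕ| : length (locations T) ≡ length sℕ
    |locations|≡|sℕ| = trans (length-locations T) (sym |sℕ|)
    sℕ↗ : Linked _≤_ sℕ
    sℕ↗ = Compatible⇒Linked |locations|≡|sℕ| s-compat

  s↗ : Linked Fin._≤_ s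
  s↗ = Linkedₚ.map⁻ sℕ↗

  value : Entry ℕ → ℕ
  value e = nth sℕ (val e)

  W : Tableau ℕ
  W = relabel value V

  private
    value-[]= : ∀ {e} → e ∈ entries V → sℕ [ val e ]= value e
    value-[]= e∈ = nth-[]= sℕ (subst (_ <_) (sym |sℕ|) (label<K e∈))

    value-mono : ∀ {e e′} → e ∈ entries V → e′ ∈ entries V → val e ≤ val e′ → value e ≤ value e′
    value-mono e∈ e′∈ = Linked-≤-mono sℕ↗ (value-[]= e∈) (value-[]= e′∈)

    climb : ∀ {e e′ r} → e ∈ entries V → e′ ∈ entries V → val e ≤ val e′ → value e ≡ value e′ → loc e ≡ plus r →
            ∃ λ r′ → loc e′ ≡ plus r′ × r′ ≤ r
    climb e∈ e′∈ e≤e′ same loc≡ = Compatible-plateau |locations|≡|sℕ| s-compat e≤e′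
      (value-[]= e∈) (subst (sℕ [ _ ]=_) (sym same) (value-[]= e′∈))
      (subst (locations T [ _ ]=_) loc≡ (location-of-label e∈)) (location-of-label e′∈)

    same-row : ∀ {e e′} → e ∈ entries V → e′ ∈ entries V → loc e ≡ loc e′ → val e < val e′ → proj₂ (cell e) < proj₂ (cell e′)
    same-row {(l , j) , u} {(l′ , j′) , v} e∈ e′∈ refl u<v with <-cmp j j′
    ... | tri< j<j′ _ _ = j<j′
    ... | tri≈ _ refl _ = ⊥-elim (<-irrefl (⟨⟩=-functional (∈-entries⁻ {T = V} e∈) (∈-entries⁻ e′∈)) u<v)
    ... | tri> _ _ j′<j = ⊥-elim (<-asym u<v (proj₁ T-std (∈-entries⁻ e′∈) (∈-entries⁻ e∈) j′<j))

  ⊏-value⁺ : ∀ {e e′} → e ∈ entries V → e′ ∈ entries V → val e < val e′ → relabelEntry value e ⊏ relabelEntry value e′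
  ⊏-value⁺ {e} {e′} e∈ e′∈ e<e′ with m≤n⇒m<n∨m≡n (value-mono e∈ e′∈ (<⇒≤ e<e′))
  ... | inj₁ v<v′ = inj₁ v<v′
  ... | inj₂ same = inj₂ (same , cells (loc e) (loc e′) refl refl)
    where
      cells : ∀ l l′ → loc e ≡ l → loc e′ ≡ l′ → cell e ≺ cell e′
      cells minus    minus     l≡ l′≡ = inj₂ (trans l≡ (sym l′≡) , same-row e∈ e′∈ (trans l≡ (sym l′≡)) e<e′)
      cells minus    (plus _)  l≡ l′≡ = inj₁ (subst₂ _<ᴸ_ (sym l≡) (sym l′≡) minus<plus)
      cells (plus r) l′        l≡ l′≡ with climb e∈ e′∈ (<⇒≤ e<e′) same l≡
      ... | r′ , loc≡ , r′≤r with m≤n⇒m<n∨m≡n r′≤r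
      ...   | inj₁ r′<r = inj₁ (subst₂ _<ᴸ_ (sym l≡) (sym loc≡) (plus<plus r′<r))
      ...   | inj₂ refl = inj₂ (trans l≡ (sym loc≡) , same-row e∈ e′∈ (trans l≡ (sym loc≡)) e<e′)

  ⊏-value⁻ : ∀ {e e′} → e ∈ entries V → e′ ∈ entries V → relabelEntry value e ⊏ relabelEntry value e′ → val e < val e′
  ⊏-value⁻ {e} {e′} e∈ e′∈ e⊏e′ with <-cmp (val e) (val e′)
  ... | tri< e<e′ _ _ = e<e′
  ... | tri≈ _ e≡e′ _ rewrite label-injective e∈ e′∈ e≡e′ = ⊥-elim (⊏-irrefl e⊏e′)
  ... | tri> _ _ e′<e = ⊥-elim (⊏-irrefl (⊏-trans e⊏e′ (⊏-value⁺ e′∈ e∈ e′<e)))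

  W-semistandard : Semistandard W
  W-semistandard = rows , cols
    where
      entry : ∀ {c y} → W ⟨ c ⟩= y → ∃ λ u → (c , u) ∈ entries V × y ≡ value (c , u)
      entry W[c] = let u , V[c] , y≡ = ⟨⟩=-relabel⁻ value V W[c] in u , ∈-entries⁺ V[c] , y≡
      rows : Rows _≤_ W
      rows p q j<j′ with u , u∈ , refl ← entry p | v , v∈ , refl ← entry q =
        value-mono u∈ v∈ (<⇒≤ (proj₁ T-std (∈-entries⁻ u∈) (∈-entries⁻ v∈) j<j′))
      cols : Columns _<_ W
      cols {k} p q with u , u∈ , refl ← entry p | v , v∈ , refl ← entry q
        with u<v ← proj₁ (proj₂ T-std) (∈-entries⁻ u∈) (∈-entries⁻ v∈)
        with m≤n⇒m<n∨m≡n (value-mono u∈ v∈ (<⇒≤ u<v))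
      ... | inj₁ value< = value<
      ... | inj₂ same with _ , refl , k+1≤k ← climb u∈ v∈ (<⇒≤ u<v) same refl = ⊥-elim (1+n≰n k+1≤k)

  rank-W : ∀ {e} → e ∈ entries V → rank W (relabelEntry value e) ≡ val e
  rank-W {e} e∈ = begin
    count (_⊏? relabelEntry value e) (entries W)
      ≡⟨ cong (count (_⊏? _)) (entries-relabel value V) ⟩
    count (_⊏? relabelEntry value e) (map (relabelEntry value) (entries V))
      ≡⟨ count-map (_⊏? _) (relabelEntry value) (entries V) ⟩
    count ((_⊏? relabelEntry value e) ∘ relabelEntry value) (entries V)
      ≡⟨ ≤-antisym (count-mono _ _ (entries V) (λ e′∈ → ⊏-value⁻ e′∈ e∈))
                   (count-mono _ _ (entries V) (λ e′∈ → ⊏-value⁺ e′∈ e∈)) ⟩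
    count ((_<? val e) ∘ val) (entries V)
      ≡⟨ count-map (_<? val e) val (entries V) ⟨
    count (_<? val e) (map val (entries V))
      ≡⟨ cong (count (_<? val e)) (map-val-entries V) ⟩
    count (_<? val e) (flatten V)
      ≡⟨ count-labels (<⇒≤ (label<K e∈)) ⟩
    val e ∎
    where open ≡-Reasoning

  private
    label<K′ : ∀ {t} → t ∈ flatten V → t < K
    label<K′ t∈ = ∈-upTo⁻ (↭ₚ.Any-resp-↭ labels↭ t∈)

  mapᵀ-toℕ-fill : mapᵀ toℕ (fill (T , s)) ≡ W
  mapᵀ-toℕ-fill = trans (mapᵀ-concatMapᵀ toℕ (elemAt s) (nth sℕ) V λ t∈ →
      trans (map-elemAt toℕ s _) (elemAt-[]= (nth-[]= sℕ (subst (_ <_) (sym |sℕ|) (label<K′ t∈)))))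
    (mapᵀ≡relabel (nth sℕ) V)

  flatten-fill↭ : flatten (fill (T , s)) ↭ s
  flatten-fill↭ = begin
    flatten (fill (T , s))          ≡⟨ flatten-concatMapᵀ (elemAt s) V ⟩
    concatMap (elemAt s) (flatten V) ↭⟨ concatMap-↭ (elemAt s) labels↭ ⟩
    concatMap (elemAt s) (upTo K)    ≡⟨ cong (concatMap (elemAt s) ∘ upTo) (sym |s|) ⟩
    concatMap (elemAt s) (upTo (length s)) ≡⟨ concatMap-elemAt-upTo s ⟩
    s                                ∎
    where open ↭.PermutationReasoning


module Standardization {M K : ℕ} (S : Tableau (Fin M)) (|S| : length (flatten S) ≡ K)
                       (S-semistd : Semistandard (mapᵀ toℕ S)) where

  U : Tableau ℕ
  U = mapᵀ toℕ S

  V : Tableau ℕ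
  V = relabel (rank U) U

  private
    |entries| : length (entries U) ≡ K
    |entries| = trans (length-entries U) (trans (cong length (flatten-mapᵀ toℕ S)) (trans (length-map toℕ (flatten S)) |S|))

    entry : ∀ {c y} → V ⟨ c ⟩= y → ∃ λ x → (c , x) ∈ entries U × y ≡ rank U (c , x)
    entry V[c] = let x , U[c] , y≡ = ⟨⟩=-relabel⁻ (rank U) U V[c] in x , ∈-entries⁺ U[c] , y≡

  V-standard : Standard V
  V-standard = rows , cols , unique
    where
      rows : Rows _<_ V
      rows p q j<j′ with x , x∈ , refl ← entry p | y , y∈ , refl ← entry q
        with m≤n⇒m<n∨m≡n (proj₁ S-semistd (∈-entries⁻ x∈) (∈-entries⁻ y∈) j<j′)
      ... | inj₁ x<y = rank-mono U x∈ (inj₁ x<y)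
      ... | inj₂ x≡y = rank-mono U x∈ (inj₂ (x≡y , inj₂ (refl , j<j′)))
      cols : Columns _<_ V
      cols p q with x , x∈ , refl ← entry p | y , y∈ , refl ← entry q =
        rank-mono U x∈ (inj₁ (proj₂ S-semistd (∈-entries⁻ x∈) (∈-entries⁻ y∈)))
      unique : Unique (flatten V)
      unique = subst Unique
        (trans (trans (map-∘ (entries U)) (cong (map val) (sym (entries-relabel (rank U) U)))) (map-val-entries V))
        (map⁺-injectiveOn (rank U) (entries-unique U) (rank-injective U))

  mapᵀ-toℕ-standardize : mapᵀ toℕ (proj₁ (standardize K S)) ≡ V
  mapᵀ-toℕ-standardize = mapᵀ-concatMapᵀ toℕ (elemAt (allFin K) ∘ rank U) (rank U) (annotate U) λ {e} e∈ →
    let r<K = subst (rank U e <_) |entries| (rank-<length U e∈) in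
    trans (cong (map toℕ) (elemAt-[]= (subst (allFin K [_]= Fin.fromℕ< r<K) (toℕ-fromℕ< r<K) (tabulate-[]= id (Fin.fromℕ< r<K)))))
            (cong [_] (toℕ-fromℕ< r<K))

  module Arrangement (s : List (Fin M)) (s↗ : Linked Fin._≤_ s) (s↭ : s ↭ flatten S) where

    private
      sℕ : List ℕ
      sℕ = map toℕ s

      sℕ↗ : AllPairs _≤_ sℕ
      sℕ↗ = Linkedₚ.Linked⇒AllPairs ≤-trans (Linkedₚ.map⁺ s↗)

      sℕ↭ : sℕ ↭ map val (entries U)
      sℕ↭ = ↭-trans (↭ₚ.map⁺ toℕ s↭) (↭.↭-reflexive (trans (sym (flatten-mapᵀ toℕ S)) (sym (map-val-entries U))))

      |sℕ| : length sℕ ≡ length (entries U)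
      |sℕ| = trans (↭ₚ.↭-length sℕ↭) (length-map val (entries U))

      count-sℕ : ∀ k → count (_<? k) sℕ ≡ count ((_<? k) ∘ val) (entries U)
      count-sℕ k = trans (count-↭ (_<? k) sℕ↭) (count-map (_<? k) val (entries U))

      count-below : ∀ {e} → count (_<? val e) sℕ ≤ rank U e
      count-below {e} = subst (_≤ rank U e) (sym (count-sℕ (val e))) (count-mono _ (_⊏? e) (entries U) λ _ v′<v → inj₁ v′<v)

      rank<count-upto : ∀ {e} → e ∈ entries U → rank U e < count (_<? suc (val e)) sℕ
      rank<count-upto {e} e∈ = subst (rank U e <_) (sym (count-sℕ (suc (val e))))
        (count-strict (_⊏? e) _ (entries U) (λ _ e′⊏e → s≤s (proj₁ (⊏⇒Step e′⊏e))) e∈ (n<1+n (val e)) ⊏-irrefl)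

    sℕ[rank] : ∀ {e} → e ∈ entries U → sℕ [ rank U e ]= val e
    sℕ[rank] {e} e∈ with <length⇒[]= sℕ (subst (rank U e <_) (sym |sℕ|) (rank-<length U e∈))
    ... | w , sℕ[r] with <-cmp w (val e)
    ... | tri≈ _ refl _ = sℕ[r]
    ... | tri< w<v _ _ = ⊥-elim (<⇒≱ ([]=⇒<count (_<? val e) ≤-<-trans sℕ↗ sℕ[r] w<v) count-below)
    ... | tri> _ _ v<w = ⊥-elim (<⇒≱ v<w (≤-pred (<count⇒[]= (_<? suc (val e)) ≤-<-trans sℕ↗ sℕ[r] (rank<count-upto e∈))))

    module _ (T′ : Tableau (Fin K)) (T′≡V : mapᵀ toℕ T′ ≡ V) where

      T′-standard : Standard (mapᵀ toℕ T′)
      T′-standard = subst Standard (sym T′≡V) V-standard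

      |T′| : length (flatten T′) ≡ K
      |T′| = begin
        length (flatten T′)            ≡⟨ length-map toℕ (flatten T′) ⟨
        length (map toℕ (flatten T′))  ≡⟨ cong length (flatten-mapᵀ toℕ T′) ⟨
        length (flatten (mapᵀ toℕ T′)) ≡⟨ cong (length ∘ flatten) T′≡V ⟩
        length (flatten V)             ≡⟨ length-entries V ⟨
        length (entries V)             ≡⟨ cong length (entries-relabel (rank U) U) ⟩
        length (map _ (entries U))     ≡⟨ length-map _ (entries U) ⟩
        length (entries U)             ≡⟨ |entries| ⟩
        K                              ∎
        where open ≡-Reasoning

      private
        module L = StandardLabels T′ |T′| T′-standard

        label<K : ∀ {t l} → locations T′ [ t ]= l → t < K
        label<K ls[t] = subst (_ <_) (length-locations T′) ([]=⇒<length ls[t])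

        at-label : ∀ {t} → t < K → ∃ λ e → e ∈ entries U × rank U e ≡ t × locations T′ [ t ]= loc e
        at-label t<K =
          let e₁ , e₁∈ , v≡t = L.label-entry t<K
              e , e∈ , e₁≡ = ∈-entries-relabel⁻ (rank U) U (subst (λ W → e₁ ∈ entries W) T′≡V e₁∈)
          in e , e∈ , trans (cong val (sym e₁≡)) v≡t , subst₂ (locations T′ [_]=_) v≡t (cong loc e₁≡) (L.location-of-label e₁∈)

        adjacent-labels : ∀ {t l l′ a b} → locations T′ [ t ]= l → locations T′ [ suc t ]= l′ → sℕ [ t ]= a → sℕ [ suc t ]= b →
                          Step (l , a) (l′ , b)
        adjacent-labels {t} ls[t] ls[t+1] s[t] s[t+1] =
          let e  , e∈  , r≡t    , ls[t]′   = at-label (label<K ls[t])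
              e′ , e′∈ , r′≡t+1 , ls[t+1]′ = at-label (label<K ls[t+1])
              s[t]′   = subst (λ i → sℕ [ i ]= val e) r≡t (sℕ[rank] e∈)
              s[t+1]′ = subst (λ i → sℕ [ i ]= val e′) r′≡t+1 (sℕ[rank] e′∈)
              e⊏e′    = rank-<⇒⊏ U e∈ e′∈ (subst₂ _<_ (sym r≡t) (sym r′≡t+1) (n<1+n t))
          in subst₂ Step (cong₂ _,_ ([]=-functional ls[t]′ ls[t]) ([]=-functional s[t]′ s[t]))
                         (cong₂ _,_ ([]=-functional ls[t+1]′ ls[t+1]) ([]=-functional s[t+1]′ s[t+1]))
                         (⊏⇒Step e⊏e′)

      compatible : Compatible (locations T′) sℕ
      compatible = adjacent⇒Compatible adjacent-labels

      fill≡S : fill (T′ , s) ≡ S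
      fill≡S = begin
        concatMapᵀ (elemAt s) (mapᵀ toℕ T′)
          ≡⟨ cong (concatMapᵀ (elemAt s)) T′≡V ⟩
        concatMapᵀ (elemAt s) (mapᵀ (rank U) (annotate U))
          ≡⟨ concatMapᵀ-mapᵀ (elemAt s) (rank U) (annotate U) ⟩
        concatMapᵀ (elemAt s ∘ rank U) (annotate U)
          ≡⟨ cong (concatMapᵀ (elemAt s ∘ rank U) ∘ annotate) (mapᵀ≡relabel toℕ S) ⟩
        concatMapᵀ (elemAt s ∘ rank U) (annotate (relabel (toℕ ∘ val) S))
          ≡⟨ cong (concatMapᵀ (elemAt s ∘ rank U)) (annotate-relabel (toℕ ∘ val) S) ⟩
        concatMapᵀ (elemAt s ∘ rank U) (mapᵀ (relabelEntry (toℕ ∘ val)) (annotate S))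
          ≡⟨ concatMapᵀ-mapᵀ (elemAt s ∘ rank U) _ (annotate S) ⟩
        concatMapᵀ (elemAt s ∘ rank U ∘ relabelEntry (toℕ ∘ val)) (annotate S)
          ≡⟨ mapᵀ-id _ ⟨
        mapᵀ id (concatMapᵀ (elemAt s ∘ rank U ∘ relabelEntry (toℕ ∘ val)) (annotate S))
          ≡⟨ mapᵀ-concatMapᵀ id _ val (annotate S) entry-value ⟩
        mapᵀ val (annotate S)
          ≡⟨ mapᵀ-val-annotate S ⟩
        S ∎
        where
          open ≡-Reasoning
          entry-value : ∀ {e} → e ∈ entries S → map id (elemAt s (rank U (cell e , toℕ (val e)))) ≡ [ val e ]
          entry-value e∈ with y , s[r] , toℕ≡ ← map-[]=⁻ toℕ (sℕ[rank] (∈-entries⁺ (⟨⟩=-mapᵀ⁺ toℕ (∈-entries⁻ {T = S} e∈))))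
            rewrite toℕ-injective toℕ≡ | elemAt-[]= s[r] = refl

module Expansion {c ℓ} (R : CommutativeSemiring c ℓ) (M p : ℕ) (ls : List ℕ) where
  open CommutativeSemiring R using (Carrier; 1#; _≈_)
    renaming (_*_ to _⊗_; *-cong to ⊗-cong; *-identityˡ to ⊗-identityˡ;
              refl to ≈-refl; sym to ≈-sym; trans to ≈-trans; reflexive to ≈-reflexive)
  private
    module Σ = BigOperator (CommutativeSemiring.+-commutativeMonoid R)
    module Π = BigOperator (CommutativeSemiring.*-commutativeMonoid R)

  K : ℕ
  K = sum ls + p

  sequences : Tableau (Fin K) → List (List (Fin M))
  sequences T = filterᵇ (okSeq R (kinds R (comp T))) (allLists (allFin M) (length (kinds R (comp T))))

  pairs : List (Tableau (Fin K) × List (Fin M))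
  pairs = concatMap (λ T → map (T ,_) (sequences T)) (SBT p ls)

  ∈-pairs⁻ : ∀ {T s} → (T , s) ∈ pairs → T ∈ SBT p ls × s ∈ sequences T
  ∈-pairs⁻ Ts∈ with T , T∈ , Ts∈′ ← find (∈-concatMap⁻ (λ T → map (T ,_) (sequences T)) {xs = SBT p ls} Ts∈)
               with s , s∈ , refl ← ∈-map⁻ (T ,_) Ts∈′ = T∈ , s∈

  ∈-pairs⁺ : ∀ {T s} → T ∈ SBT p ls → s ∈ sequences T → (T , s) ∈ pairs
  ∈-pairs⁺ {T} {s} T∈ s∈ = ∈-concatMap⁺ (λ T → map (T ,_) (sequences T)) (lose T∈ (∈-map⁺ (T ,_) s∈))

  pairs-unique : Unique pairs
  pairs-unique = Unique.concat⁺ {xss = map (λ T → map (T ,_) (sequences T)) (SBT p ls)} each-unique disjoint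
    where
      each-unique : All Unique (map (λ T → map (T ,_) (sequences T)) (SBT p ls))
      each-unique = Allₚ.map⁺ (All.tabulate λ {T} _ →
        Unique.map⁺ (cong proj₂) (Unique.filter⁺ _ (allLists⁺ (allFin M) (Unique.allFin⁺ M) (length (kinds R (comp T))))))
      first : ∀ {T} {Ts : Tableau (Fin K) × List (Fin M)} → Ts ∈ map (T ,_) (sequences T) → proj₁ Ts ≡ T
      first {T} Ts∈ with _ , _ , refl ← ∈-map⁻ (T ,_) Ts∈ = refl
      disjoint : AllPairs Disjoint (map (λ T → map (T ,_) (sequences T)) (SBT p ls))
      disjoint = AllPairsₚ.map⁺
        (AllPairs.map (λ T≢T′ {_} (Ts∈ , Ts∈′) → T≢T′ (trans (sym (first Ts∈)) (first Ts∈′))) (SBT-unique {p} {ls}))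

  length-kinds : ∀ T → length (kinds R (comp T)) ≡ K
  length-kinds T =
    trans (cong length (kinds-compLocs R (locations T))) (trans (length-kindsOf R (locations T)) (length-locations T))

  private
    |locations|≡ : ∀ {T} {s : List (Fin M)} → length s ≡ K → length (locations T) ≡ length s
    |locations|≡ {T} |s| = trans (length-locations T) (sym |s|)

  ∈-sequences⁻ : ∀ {T s} → s ∈ sequences T → length s ≡ K × Compatible (locations T) (map toℕ s)
  ∈-sequences⁻ {T} {s} s∈ =
    let s∈′ , ok = ∈-filter⁻ (T? ∘ okSeq R (kinds R (comp T))) {xs = allLists (allFin M) (length (kinds R (comp T)))} s∈
        |s| = trans (proj₁ (∈-allLists⁻ (allFin M) _ s∈′)) (length-kinds T)
    in |s| , okSeq⇒Compatible R (locations T) s (|locations|≡ {T} {s} |s|)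
                (subst (λ ks → Bool.T (okSeq R ks s)) (kinds-compLocs R (locations T)) ok)

  ∈-sequences⁺ : ∀ {T s} → length s ≡ K → Compatible (locations T) (map toℕ s) → s ∈ sequences T
  ∈-sequences⁺ {T} {s} |s| compat = ∈-filter⁺ (T? ∘ okSeq R (kinds R (comp T)))
    (subst (λ n → s ∈ allLists (allFin M) n) (trans |s| (sym (length-kinds T)))
      (∈-allLists⁺ (allFin M) (All.tabulate λ {x} _ → ∈-allFin x)))
    (subst (λ ks → Bool.T (okSeq R ks s)) (sym (kinds-compLocs R (locations T)))
      (Compatible⇒okSeq R (locations T) s (|locations|≡ {T} {s} |s|) compat))

  module PairFacts {T : Tableau (Fin K)} {s : List (Fin M)} (Ts∈ : (T , s) ∈ pairs) where

    private
      T∈ : T ∈ SBT p ls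
      T∈ = proj₁ (∈-pairs⁻ Ts∈)
      shape-T : shape T ≡ (p , ls)
      shape-T = proj₁ (∈-SBT⁻ {p} {ls} T∈)
      T-std : Standard (mapᵀ toℕ T)
      T-std = proj₂ (∈-SBT⁻ {p} {ls} T∈)
      |T| : length (flatten T) ≡ K
      |T| = length-flatten T shape-T
      |s| : length s ≡ K
      |s| = proj₁ (∈-sequences⁻ {T} {s} (proj₂ (∈-pairs⁻ Ts∈)))
      s-compat : Compatible (locations T) (map toℕ s)
      s-compat = proj₂ (∈-sequences⁻ {T} {s} (proj₂ (∈-pairs⁻ Ts∈)))

    open Filling T |T| T-std s |s| s-compat
    open StandardLabels T |T| T-std using (V)

    private
      F : Tableau (Fin M)
      F = fill (T , s)

      shape-F : shape F ≡ (p , ls)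
      shape-F = begin
        shape F              ≡⟨ shape-mapᵀ toℕ F ⟨
        shape (mapᵀ toℕ F)   ≡⟨ cong shape mapᵀ-toℕ-fill ⟩
        shape W              ≡⟨ shape-relabel value V ⟩
        shape V              ≡⟨ shape-mapᵀ toℕ T ⟩
        shape T              ≡⟨ shape-T ⟩
        (p , ls)             ∎
        where open ≡-Reasoning

      F-semistandard : Semistandard (mapᵀ toℕ F)
      F-semistandard = subst Semistandard (sym mapᵀ-toℕ-fill) W-semistandard

      |F| : length (flatten F) ≡ K
      |F| = trans (↭ₚ.↭-length flatten-fill↭) |s|

    fill∈SSBT : F ∈ SSBT M p ls
    fill∈SSBT = ∈-SSBT⁺ F shape-F F-semistandard

    standardize-fill : standardize K F ≡ (T , s)
    standardize-fill = cong₂ _,_ (mapᵀ-injective toℕ-injective labels) sorted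
      where
        open Standardization F |F| F-semistandard using (mapᵀ-toℕ-standardize)
        labels : mapᵀ toℕ (proj₁ (standardize K F)) ≡ mapᵀ toℕ T
        labels = begin
          mapᵀ toℕ (proj₁ (standardize K F))                    ≡⟨ mapᵀ-toℕ-standardize ⟩
          relabel (rank (mapᵀ toℕ F)) (mapᵀ toℕ F)              ≡⟨ cong (λ U → relabel (rank U) U) mapᵀ-toℕ-fill ⟩
          relabel (rank W) (relabel value V)                    ≡⟨ relabel-relabel value (rank W) V ⟩
          relabel (rank W ∘ relabelEntry value) V               ≡⟨ relabel-cong V rank-W ⟩
          relabel val V                                         ≡⟨ mapᵀ-val-annotate V ⟩
          V                                                     ∎
          where open ≡-Reasoning
        sorted : sort (flatten F) ≡ s
        sorted = ≋⇒≡ (↗↭↗⇒≋ (Finₚ.≤-totalOrder M) (sort-↗ (flatten F)) s↗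
          (↭.↭⇒↭ₛ (↭-trans (sort-↭ (flatten F)) flatten-fill↭)))

    private
      open StandardLabels T |T| T-std using (labels↭; location-of-label)

      h : ℕ → List (Loc × Fin M)
      h t = zip (elemAt (locations T) t) (elemAt s t)

      location-elemAt : ∀ {t c} → V ⟨ c ⟩= t → elemAt (locations T) t ≡ [ proj₁ c ]
      location-elemAt V[c] = elemAt-[]= (location-of-label (∈-entries⁺ V[c]))

    weight-fill : ∀ (x : Fin M → Carrier) → weight R x (kinds R (comp T)) s ≈ Π.⨁ (concat (proj₂ F)) x
    weight-fill x = begin
      weight R x (kinds R (comp T)) s
        ≡⟨ cong (λ ks → weight R x ks s) (kinds-compLocs R (locations T)) ⟩
      weight R x (kindsOf R (locations T)) s
        ≈⟨ weight-kindsOf R x (locations T) s |locations|≡|s| ⟩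
      Π.⨁ (zip (locations T) s) w
        ≡⟨ cong (λ zs → Π.⨁ zs w) (zip≡concatMap-elemAt (locations T) s |locations|≡|s|) ⟩
      Π.⨁ (concatMap h (upTo (length (locations T)))) w
        ≡⟨ cong (λ n → Π.⨁ (concatMap h (upTo n)) w) (length-locations T) ⟩
      Π.⨁ (concatMap h (upTo K)) w
        ≈⟨ Π.⨁-↭ w (concatMap-↭ h (↭-sym labels↭)) ⟩
      Π.⨁ (concatMap h (flatten V)) w
        ≡⟨ cong (λ zs → Π.⨁ zs w) (concatMap-++ h (proj₁ V) (concat (proj₂ V))) ⟩
      Π.⨁ (concatMap h (proj₁ V) ++ concatMap h (concat (proj₂ V))) w
        ≈⟨ Π.⨁-++ (concatMap h (proj₁ V)) _ w ⟩
      Π.⨁ (concatMap h (proj₁ V)) w ⊗ Π.⨁ (concatMap h (concat (proj₂ V))) w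
        ≈⟨ ⊗-cong T⁻-trivial T⁺-values ⟩
      1# ⊗ Π.⨁ (concatMap (elemAt s) (concat (proj₂ V))) x
        ≈⟨ ⊗-identityˡ _ ⟩
      Π.⨁ (concatMap (elemAt s) (concat (proj₂ V))) x
        ≡⟨ cong (λ zs → Π.⨁ zs x) (concat-map-concatMap (elemAt s) (proj₂ V)) ⟨
      Π.⨁ (concat (proj₂ F)) x ∎
      where
        open import Relation.Binary.Reasoning.Setoid (CommutativeSemiring.setoid R)
        w : Loc × Fin M → Carrier
        w = contribution R x
        |locations|≡|s| : length (locations T) ≡ length s
        |locations|≡|s| = trans (length-locations T) (sym |s|)
        T⁻-trivial : Π.⨁ (concatMap h (proj₁ V)) w ≈ 1#
        T⁻-trivial = ≈-trans (Π.⨁-concatMap h (proj₁ V) w) (Π.⨁-identity (proj₁ V) _ λ t∈ →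
          let _ , m[j] = ∈⇒[]= t∈ in trivial (elemAt s _) (location-elemAt (in⁻ m[j])))
          where
            trivial : ∀ {t} ys → elemAt (locations T) t ≡ [ minus ] → Π.⨁ (zip (elemAt (locations T) t) ys) w ≈ 1#
            trivial []      eq rewrite eq = ≈-refl
            trivial (y ∷ _) eq rewrite eq = ⊗-identityˡ 1#
        T⁺-values : Π.⨁ (concatMap h (concat (proj₂ V))) w ≈ Π.⨁ (concatMap (elemAt s) (concat (proj₂ V))) x
        T⁺-values = ≈-trans (Π.⨁-concatMap h (concat (proj₂ V)) w) (≈-trans (Π.⨁-cong (concat (proj₂ V)) λ t∈ →
            let row , t∈row , row∈ = ∈-concat⁻′ (proj₂ V) t∈ ; _ , ps[k] = ∈⇒[]= row∈ ; _ , row[j] = ∈⇒[]= t∈row in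
            values (elemAt-cases s _) (location-elemAt (in⁺ ps[k] row[j])))
          (≈-sym (Π.⨁-concatMap (elemAt s) (concat (proj₂ V)) x)))
          where
            values : ∀ {t k} → elemAt s t ≡ [] ⊎ ∃ (λ y → elemAt s t ≡ [ y ]) → elemAt (locations T) t ≡ [ plus k ] →
                     Π.⨁ (h t) w ≈ Π.⨁ (elemAt s t) x
            values (inj₁ none)       eq rewrite eq | none = ≈-refl
            values (inj₂ (y , one)) eq rewrite eq | one  = ≈-refl

  module TableauFacts {S : Tableau (Fin M)} (S∈ : S ∈ SSBT M p ls) where

    private
      shape-S : shape S ≡ (p , ls)
      shape-S = proj₁ (∈-SSBT⁻ {M} {p} {ls} S∈)
      |S| : length (flatten S) ≡ K
      |S| = length-flatten S shape-S

    open Standardization S |S| (proj₂ (∈-SSBT⁻ {M} {p} {ls} S∈))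
    open Arrangement (sort (flatten S)) (sort-↗ (flatten S)) (sort-↭ (flatten S))

    private
      T′ : Tableau (Fin K)
      T′ = proj₁ (standardize K S)

      shape-T′ : shape T′ ≡ (p , ls)
      shape-T′ = begin
        shape T′             ≡⟨ shape-mapᵀ toℕ T′ ⟨
        shape (mapᵀ toℕ T′)  ≡⟨ cong shape mapᵀ-toℕ-standardize ⟩
        shape V              ≡⟨ shape-relabel (rank U) U ⟩
        shape U              ≡⟨ shape-mapᵀ toℕ S ⟩
        shape S              ≡⟨ shape-S ⟩
        (p , ls)             ∎
        where open ≡-Reasoning

    standardize∈pairs : standardize K S ∈ pairs
    standardize∈pairs = ∈-pairs⁺ (∈-SBT⁺ T′ shape-T′ (T′-standard T′ mapᵀ-toℕ-standardize))
      (∈-sequences⁺ {T′} {sort (flatten S)} (trans (↭ₚ.↭-length (sort-↭ (flatten S))) |S|) (compatible T′ mapᵀ-toℕ-standardize))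

    fill-standardize : fill (standardize K S) ≡ S
    fill-standardize = fill≡S T′ mapᵀ-toℕ-standardize

  ⨁-pairs : ∀ (f : Tableau (Fin K) → List (Fin M) → Carrier) →
            Σ.⨁ (SBT p ls) (λ T → Σ.⨁ (sequences T) (f T)) ≈ Σ.⨁ pairs (uncurry f)
  ⨁-pairs f = begin
    Σ.⨁ (SBT p ls) (λ T → Σ.⨁ (sequences T) (f T))
      ≈⟨ Σ.⨁-cong (SBT p ls) (λ {T} _ → ≈-reflexive (sym (Σ.⨁-map (T ,_) (sequences T) (uncurry f)))) ⟩
    Σ.⨁ (SBT p ls) (λ T → Σ.⨁ (map (T ,_) (sequences T)) (uncurry f))
      ≈⟨ Σ.⨁-concatMap (λ T → map (T ,_) (sequences T)) (SBT p ls) (uncurry f) ⟨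
    Σ.⨁ pairs (uncurry f) ∎
    where open import Relation.Binary.Reasoning.Setoid (CommutativeSemiring.setoid R)

  expansion : ∀ (x : Fin M → Carrier) → schurP R M p ls x ≈ Σ[_]_ R (SBT p ls) (λ T → Ftilde R M (comp T) x)
  expansion x = ≈-sym (≈-trans (⨁-pairs (λ T → weight R x (kinds R (comp T))))
    (Σ.⨁-bijection _ (λ S → Π.⨁ (concat (proj₂ S)) x) fill (standardize K) pairs-unique (SSBT-unique p ls)
      PairFacts.fill∈SSBT TableauFacts.standardize∈pairs PairFacts.standardize-fill TableauFacts.fill-standardize
      (λ Ts∈ → PairFacts.weight-fill Ts∈ x)))

-- The identity holds for arbitrary row lengths.
proposition2 : ∀ {c ℓ} (R : CommutativeSemiring c ℓ) (M p : ℕ) (λs : List ℕ) →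
    IsPartition λs → (x : Fin M → CommutativeSemiring.Carrier R) →
    CommutativeSemiring._≈_ R (schurP R M p λs x)
      (Σ[_]_ R (SBT p λs) (λ T → Ftilde R M (comp T) x))
proposition2 R M p λs _ x = Expansion.expansion R M p λs x
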